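{- For $n\ge 1$ let $a_n = |S_n^2(231,321)|$. Then $a_1=1$ and $a_{n+1} = 4\cdot 3^{n-1}$ for all $n\ge 1$.
   Context: A $3$-permutation of size $n$ is an ordered pair $(\sigma,\sigma')$ of permutations of $[n]=\{1,\dots,n\}$. A (classical) permutation $\tau\in S_n$ contains a pattern $\pi\in S_k$ if there are indices $c_1<\dots<c_k$ such that $\tau(c_1)\cdots\tau(c_k)$ is order-isomorphic to $\pi$, and avoids $\pi$ otherwise. A $3$-permutation $(\sigma,\sigma')$ avoids a pattern $\pi\in S_k$ if each of the three permutations $\sigma$, $\sigma'$, and $\sigma'\circ\sigma^{ -1}$ (where $(\sigma'\circ\sigma^{ -1})(i)=\sigma'(\sigma^{ -1}(i))$) avoids $\pi$. $S_n^2(\pi_1,\dots,\pi_m)$ denotes the set of $3$-permutations of size $n$ avoiding each of $\pi_1,\dots,\pi_m$. Patterns are written in one-line notation. -}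

module Defs where

open import Data.Bool using (Bool; true; false; _∧_; _∨_; not)
open import Data.Nat using (ℕ; zero; suc; _<ᵇ_; _≡ᵇ_)
open import Data.Fin using (Fin; toℕ) renaming (zero to fz; suc to fs)
open import Data.Vec using (Vec; []; _∷_; lookup; tabulate)
open import Data.List using (List; []; _∷_; [_]; map; concatMap; allFin; filterᵇ; length; cartesianProduct)
open import Data.Product using (_×_; _,_)

-- A permutation of [n] (or a word of length k over [n]) in one-line notation,
-- 0-indexed: position i ↦ value (lookup v i).

allVecs : (k n : ℕ) → List (Vec (Fin n) k)
allVecs zero    n = [ [] ]
allVecs (suc k) n = concatMap (λ v → map (λ x → x ∷ v) (allFin n)) (allVecs k n)

allᵇ : {A : Set} → (A → Bool) → List A → Bool
allᵇ p []       = true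
allᵇ p (x ∷ xs) = p x ∧ allᵇ p xs

anyᵇ : {A : Set} → (A → Bool) → List A → Bool
anyᵇ p []       = false
anyᵇ p (x ∷ xs) = p x ∨ anyᵇ p xs

_=ᶠ_ : {n : ℕ} → Fin n → Fin n → Bool
i =ᶠ j = toℕ i ≡ᵇ toℕ j

_<ᶠ_ : {n : ℕ} → Fin n → Fin n → Bool
i <ᶠ j = toℕ i <ᵇ toℕ j

isPerm : {n : ℕ} → Vec (Fin n) n → Bool
isPerm {n} v = allᵇ (λ i → allᵇ (λ j → (i =ᶠ j) ∨ not (lookup v i =ᶠ lookup v j)) (allFin n)) (allFin n)

findFirst : {n : ℕ} → (Fin n → Bool) → Fin n → List (Fin n) → Fin n
findFirst p d []       = d
findFirst p d (i ∷ is) with p i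
... | true  = i
... | false = findFirst p d is

inverse : {n : ℕ} → Vec (Fin n) n → Vec (Fin n) n
inverse {n} σ = tabulate (λ j → findFirst (λ i → lookup σ i =ᶠ j) j (allFin n))

compose : {n : ℕ} → Vec (Fin n) n → Vec (Fin n) n → Vec (Fin n) n
compose τ ρ = tabulate (λ i → lookup τ (lookup ρ i))

increasing : {k n : ℕ} → Vec (Fin n) k → Bool
increasing {k} c = allᵇ (λ i → allᵇ (λ j → not (i <ᶠ j) ∨ (lookup c i <ᶠ lookup c j)) (allFin k)) (allFin k)

orderIso : {k n : ℕ} → Vec (Fin n) n → Vec (Fin k) k → Vec (Fin n) k → Bool
orderIso {k} τ π c = allᵇ (λ i → allᵇ (λ j →
  eqB (lookup τ (lookup c i) <ᶠ lookup τ (lookup c j)) (lookup π i <ᶠ lookup π j)) (allFin k)) (allFin k)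
  where
  eqB : Bool → Bool → Bool
  eqB true  b = b
  eqB false b = not b

contains : {k n : ℕ} → Vec (Fin n) n → Vec (Fin k) k → Bool
contains {k} {n} τ π = anyᵇ (λ c → increasing c ∧ orderIso τ π c) (allVecs k n)

avoids : {k n : ℕ} → Vec (Fin n) n → Vec (Fin k) k → Bool
avoids τ π = not (contains τ π)

-- the 3-permutation (σ, σ') avoids π: σ, σ' and σ' ∘ σ⁻¹ all avoid π
avoids3 : {k n : ℕ} → Vec (Fin n) n → Vec (Fin n) n → Vec (Fin k) k → Bool
avoids3 σ σ' π = avoids σ π ∧ avoids σ' π ∧ avoids (compose σ' (inverse σ)) π

-- patterns 231 and 321 (0-indexed one-line notation)
p231 : Vec (Fin 3) 3
p231 = fs fz ∷ fs (fs fz) ∷ fz ∷ []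

p321 : Vec (Fin 3) 3
p321 = fs (fs fz) ∷ fs fz ∷ fz ∷ []

S2-231-321 : (n : ℕ) → List (Vec (Fin n) n × Vec (Fin n) n)
S2-231-321 n = filterᵇ (λ { (σ , σ') → isPerm σ ∧ isPerm σ' ∧ avoids3 σ σ' p231 ∧ avoids3 σ σ' p321 })
                       (cartesianProduct (allVecs n n) (allVecs n n))

a : ℕ → ℕ
a n = length (S2-231-321 n)

-- A permutation avoids 231 and 321 iff no entry is preceded by two larger ones. For such a permutation of
-- [0, k + 1] the last entry is k + 1 or k (its type), and deleting it, renaming k + 1 to k in the second case,
-- leaves such a permutation of [0, k]; conversely each one extends in exactly these two ways. For a pair
-- (σ, σ′) the third condition says that σ′ ∘ σ⁻¹ has the same property, and it survives extending both
-- permutations unless σ is extended by k while σ′ ∘ σ⁻¹ does not fix the old maximum k, which for a good pair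
-- happens exactly when σ and σ′ have different types. So with g(n) good pairs of size n and s(m) good pairs of
-- size m + 1 whose permutations have equal types, g(k + 2) = 2 g(k + 1) + 2 s(k) and s(k + 1) = g(k + 1) + s(k),
-- while g(1) = s(0) = 1; hence g(k + 2) = 4 · 3^k.

module Submission where

open import Data.Bool using (Bool; true; false; _∧_; _∨_; not; T; if_then_else_)
open import Data.Nat
  using (ℕ; zero; suc; _+_; _*_; _^_; _∸_; _<_; _≤_; _≥_; _<ᵇ_; _≡ᵇ_; z≤n; s≤s; s≤s⁻¹; _≟_; _≤?_)
open import Data.Nat.Properties
  using (+-assoc; +-commutativeSemigroup; +-identityʳ; 1+n≰n; <-cmp; <-irrefl; <-trans; <-≤-trans;
         <⇒≢; <⇒≤; <⇒≯; <⇒≱; m≤n⇒m<n∨m≡n; m≤n⇒m≤1+n; n<1+n; n<1⇒n≡0; n≤1+n; ≤-antisym; ≤-refl;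
         ≤-reflexive; ≤-trans; ≤∧≢⇒<; ≰⇒>; module ≤-Reasoning)
import Data.Nat.Properties as ℕₚ
open import Data.Nat.Tactic.RingSolver using (solve-∀)
import Algebra.Properties.CommutativeSemigroup
open import Data.Fin as Fin using (Fin; toℕ; fromℕ<) renaming (zero to fz; suc to fs)
import Data.Fin.Properties as Finₚ
open import Data.Vec using (Vec; []; _∷_; lookup; tabulate)
import Data.Vec.Properties as Vecₚ
open import Data.List using (List; []; _∷_; _++_; map; concat; concatMap; allFin; cartesianProduct; filterᵇ; length)
import Data.List as List
open import Data.List.Membership.Propositional using (_∈_)
open import Data.List.Membership.Propositional.Properties using (∈-allFin; ∈-map⁺; ∈-concat⁺′)
open import Data.List.Relation.Unary.Any using (here; there)
open import Data.Product using (_×_; _,_; proj₁; proj₂; ∃-syntax)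
import Data.Product.Properties as Productₚ
open import Data.Sum using (_⊎_; inj₁; inj₂)
open import Data.Empty using (⊥; ⊥-elim)
open import Function using (_∘_; id)
open import Relation.Nullary using (does; yes; no; contradiction)
open import Relation.Binary using (tri<; tri≈; tri>; _Preserves_⟶_)
open import Relation.Binary.Definitions using (DecidableEquality)
open import Relation.Binary.PropositionalEquality
  using (_≡_; _≢_; refl; sym; trans; cong; cong₂; subst; subst₂; module ≡-Reasoning)

open import Defs

private variable
  A B : Set
  b b′ : Bool
  i j k m n x y z : ℕ
  f f′ g g′ : ℕ → ℕ

-- Sums over lists

∑ : (A → ℕ) → List A → ℕ
∑ h []       = 0
∑ h (x ∷ xs) = h x + ∑ h xs

∑-++ : (h : A → ℕ) (xs ys : List A) → ∑ h (xs ++ ys) ≡ ∑ h xs + ∑ h ys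
∑-++ h []       ys = refl
∑-++ h (x ∷ xs) ys = trans (cong (h x +_) (∑-++ h xs ys)) (sym (+-assoc (h x) _ _))

∑-map : (h : A → ℕ) (g : B → A) (xs : List B) → ∑ h (map g xs) ≡ ∑ (h ∘ g) xs
∑-map h g []       = refl
∑-map h g (x ∷ xs) = cong (h (g x) +_) (∑-map h g xs)

∑-cong : {h h′ : A → ℕ} (xs : List A) → (∀ x → h x ≡ h′ x) → ∑ h xs ≡ ∑ h′ xs
∑-cong []       e = refl
∑-cong (x ∷ xs) e = cong₂ _+_ (e x) (∑-cong xs e)

∑-zero : {h : A → ℕ} (xs : List A) → (∀ x → h x ≡ 0) → ∑ h xs ≡ 0
∑-zero []       e = refl
∑-zero (x ∷ xs) e = cong₂ _+_ (e x) (∑-zero xs e)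

∑-+ : (h h′ : A → ℕ) (xs : List A) → ∑ (λ x → h x + h′ x) xs ≡ ∑ h xs + ∑ h′ xs
∑-+ h h′ []       = refl
∑-+ h h′ (x ∷ xs) = trans (cong (h x + h′ x +_) (∑-+ h h′ xs)) (+-interchange (h x) (h′ x) _ _)
  where open Algebra.Properties.CommutativeSemigroup +-commutativeSemigroup using () renaming (interchange to +-interchange)

∑-comm : (h : A → B → ℕ) (xs : List A) (ys : List B) →
         ∑ (λ x → ∑ (h x) ys) xs ≡ ∑ (λ y → ∑ (λ x → h x y) xs) ys
∑-comm h []       ys = sym (∑-zero ys (λ _ → refl))
∑-comm h (x ∷ xs) ys = trans (cong (∑ (h x) ys +_) (∑-comm h xs ys))
                              (sym (∑-+ (h x) (λ y → ∑ (λ x′ → h x′ y) xs) ys))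

∑-cartesianProduct : (h : A × B → ℕ) (xs : List A) (ys : List B) →
                     ∑ h (cartesianProduct xs ys) ≡ ∑ (λ x → ∑ (λ y → h (x , y)) ys) xs
∑-cartesianProduct h []       ys = refl
∑-cartesianProduct h (x ∷ xs) ys = trans (∑-++ h (map (x ,_) ys) (cartesianProduct xs ys))
                                         (cong₂ _+_ (∑-map h (x ,_) ys) (∑-cartesianProduct h xs ys))

∑-concatMap : (h : B → ℕ) (f : A → List B) (xs : List A) → ∑ h (concatMap f xs) ≡ ∑ (∑ h ∘ f) xs
∑-concatMap h f []       = refl
∑-concatMap h f (x ∷ xs) = trans (∑-++ h (f x) (concat (map f xs))) (cong (∑ h (f x) +_) (∑-concatMap h f xs))

-- xs lists every element of A exactly once, expressed through sums.
record IsEnumeration {A : Set} (xs : List A) : Set where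
  field ∑-support : (h : A → ℕ) (x : A) → (∀ y → y ≢ x → h y ≡ 0) → ∑ h xs ≡ h x
open IsEnumeration

∑-tabulate-zero : ∀ n (g : Fin n → A) (h : A → ℕ) → (∀ j → h (g j) ≡ 0) → ∑ h (List.tabulate g) ≡ 0
∑-tabulate-zero zero    g h e = refl
∑-tabulate-zero (suc n) g h e = cong₂ _+_ (e fz) (∑-tabulate-zero n (g ∘ fs) h (e ∘ fs))

∑-tabulate-point : ∀ n (g : Fin n → A) (h : A → ℕ) (i : Fin n) →
                   (∀ j → j ≢ i → h (g j) ≡ 0) → ∑ h (List.tabulate g) ≡ h (g i)
∑-tabulate-point (suc n) g h fz e =
  trans (cong (h (g fz) +_) (∑-tabulate-zero n (g ∘ fs) h (λ j → e (fs j) (λ ())))) (+-identityʳ _)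
∑-tabulate-point (suc n) g h (fs i) e =
  trans (cong (_+ ∑ h (List.tabulate (g ∘ fs))) (e fz (λ ())))
        (∑-tabulate-point n (g ∘ fs) h i (λ j j≢i → e (fs j) (j≢i ∘ Finₚ.suc-injective)))

allFin-isEnumeration : ∀ n → IsEnumeration (allFin n)
∑-support (allFin-isEnumeration n) h = ∑-tabulate-point n id h

allVecs-isEnumeration : ∀ k n → IsEnumeration (allVecs k n)
∑-support (allVecs-isEnumeration zero    n) h [] e = +-identityʳ _
∑-support (allVecs-isEnumeration (suc k) n) h (x ∷ v) e = let open ≡-Reasoning in begin
  ∑ h (concatMap (λ w → map (_∷ w) (allFin n)) (allVecs k n))
    ≡⟨ ∑-concatMap h _ (allVecs k n) ⟩
  ∑ (λ w → ∑ h (map (_∷ w) (allFin n))) (allVecs k n)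
    ≡⟨ ∑-cong (allVecs k n) (λ w → ∑-map h (_∷ w) (allFin n)) ⟩
  ∑ (λ w → ∑ (λ y → h (y ∷ w)) (allFin n)) (allVecs k n)
    ≡⟨ ∑-support (allVecs-isEnumeration k n) _ v tail-off ⟩
  ∑ (λ y → h (y ∷ v)) (allFin n)
    ≡⟨ ∑-support (allFin-isEnumeration n) _ x head-off ⟩
  h (x ∷ v)
    ∎
  where
  tail-off : ∀ w → w ≢ v → ∑ (λ y → h (y ∷ w)) (allFin n) ≡ 0
  tail-off w w≢v = ∑-zero (allFin n) (λ y → e (y ∷ w) (w≢v ∘ proj₂ ∘ Vecₚ.∷-injective))
  head-off : ∀ y → y ≢ x → h (y ∷ v) ≡ 0
  head-off y y≢x = e (y ∷ v) (y≢x ∘ proj₁ ∘ Vecₚ.∷-injective)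

cartesianProduct-isEnumeration : {xs : List A} {ys : List B} →
  IsEnumeration xs → IsEnumeration ys → IsEnumeration (cartesianProduct xs ys)
∑-support (cartesianProduct-isEnumeration {xs = xs} {ys} enum-xs enum-ys) h (x , y) e = let open ≡-Reasoning in begin
  ∑ h (cartesianProduct xs ys)            ≡⟨ ∑-cartesianProduct h xs ys ⟩
  ∑ (λ x′ → ∑ (λ y′ → h (x′ , y′)) ys) xs ≡⟨ ∑-support enum-xs _ x (λ x′ x′≢x → ∑-zero ys (λ _ → e _ (x′≢x ∘ cong proj₁))) ⟩
  ∑ (λ y′ → h (x , y′)) ys                ≡⟨ ∑-support enum-ys _ y (λ y′ y′≢y → e _ (y′≢y ∘ cong proj₂)) ⟩
  h (x , y)                               ∎

indicator : Bool → ℕ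
indicator true  = 1
indicator false = 0

count : (A → Bool) → List A → ℕ
count p = ∑ (indicator ∘ p)

length-filterᵇ : (p : A → Bool) (xs : List A) → length (filterᵇ p xs) ≡ count p xs
length-filterᵇ p []       = refl
length-filterᵇ p (x ∷ xs) with p x
... | true  = cong suc (length-filterᵇ p xs)
... | false = length-filterᵇ p xs

count-cong : {p q : A → Bool} (xs : List A) → (∀ x → p x ≡ q x) → count p xs ≡ count q xs
count-cong xs e = ∑-cong xs (cong indicator ∘ e)

-- Double counting of the pairs (x, y) with q y and f y ≡ x.
count-bijection : DecidableEquality A → {xs : List A} {ys : List B} →
  IsEnumeration xs → IsEnumeration ys → (p : A → Bool) (q : B → Bool) (f : B → A) (g : A → B) →
  (∀ y → q y ≡ true → p (f y) ≡ true) → (∀ x → p x ≡ true → q (g x) ≡ true) →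
  (∀ x → p x ≡ true → f (g x) ≡ x) → (∀ y → q y ≡ true → g (f y) ≡ y) → count p xs ≡ count q ys
count-bijection {A = A} {B = B} _≟_ {xs} {ys} enum-xs enum-ys p q f g f-closed g-closed f∘g g∘f =
  trans (∑-cong xs row) (trans (∑-comm incidence xs ys) (∑-cong ys column))
  where
  incidence : A → B → ℕ
  incidence x y = if q y then indicator (does (f y ≟ x)) else 0

  row : ∀ x → indicator (p x) ≡ ∑ (incidence x) ys
  row x with p x in px
  ... | true  = sym (trans (∑-support enum-ys (incidence x) (g x) off) at-g)
    where
    off : ∀ y → y ≢ g x → incidence x y ≡ 0
    off y y≢gx with q y in qy
    ... | false = refl
    ... | true with f y ≟ x
    ...   | no _      = refl
    ...   | yes fy≡x = ⊥-elim (y≢gx (trans (sym (g∘f y qy)) (cong g fy≡x)))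
    at-g : incidence x (g x) ≡ 1
    at-g rewrite g-closed x px with f (g x) ≟ x
    ... | yes _   = refl
    ... | no fgx≢x = ⊥-elim (fgx≢x (f∘g x px))
  ... | false = sym (∑-zero ys off)
    where
    off : ∀ y → incidence x y ≡ 0
    off y with q y in qy
    ... | false = refl
    ... | true with f y ≟ x
    ...   | no _      = refl
    ...   | yes refl with () ← trans (sym px) (f-closed y qy)

  column : ∀ y → ∑ (λ x → incidence x y) xs ≡ indicator (q y)
  column y with q y
  ... | false = ∑-zero xs (λ _ → refl)
  ... | true  = trans (∑-support enum-xs _ (f y) off) at-f
    where
    off : ∀ x → x ≢ f y → indicator (does (f y ≟ x)) ≡ 0
    off x x≢fy with f y ≟ x
    ... | yes fy≡x = ⊥-elim (x≢fy (sym fy≡x))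
    ... | no _     = refl
    at-f : indicator (does (f y ≟ f y)) ≡ 1
    at-f with f y ≟ f y
    ... | yes _     = refl
    ... | no fy≢fy = ⊥-elim (fy≢fy refl)

∧-trueˡ : ∀ {x y} → x ∧ y ≡ true → x ≡ true
∧-trueˡ {true} _ = refl

∧-trueʳ : ∀ {x y} → x ∧ y ≡ true → y ≡ true
∧-trueʳ {true} e = e

∧-true : ∀ {x y} → x ≡ true → y ≡ true → x ∧ y ≡ true
∧-true refl refl = refl

≡ᵇ-true⇒≡ : ∀ {x y} → (x ≡ᵇ y) ≡ true → x ≡ y
≡ᵇ-true⇒≡ {x} {y} e = ℕₚ.≡ᵇ⇒≡ x y (subst T (sym e) _)

≡⇒≡ᵇ-true : ∀ {x y} → x ≡ y → (x ≡ᵇ y) ≡ true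
≡⇒≡ᵇ-true {zero}  refl = refl
≡⇒≡ᵇ-true {suc x} refl = ≡⇒≡ᵇ-true {x} refl

≢⇒≡ᵇ-false : ∀ {x y} → x ≢ y → (x ≡ᵇ y) ≡ false
≢⇒≡ᵇ-false {x} {y} x≢y with x ≡ᵇ y in e
... | true  = ⊥-elim (x≢y (≡ᵇ-true⇒≡ e))
... | false = refl

<ᵇ-true⇒< : ∀ {x y} → (x <ᵇ y) ≡ true → x < y
<ᵇ-true⇒< {x} {y} e = ℕₚ.<ᵇ⇒< x y (subst T (sym e) _)

<⇒<ᵇ-true : ∀ {x y} → x < y → (x <ᵇ y) ≡ true
<⇒<ᵇ-true {x} {y} x<y with x <ᵇ y in e
... | true  = refl
... | false = ⊥-elim (subst T e (ℕₚ.<⇒<ᵇ x<y))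

≥⇒<ᵇ-false : ∀ {x y} → y ≤ x → (x <ᵇ y) ≡ false
≥⇒<ᵇ-false {x} {y} y≤x with x <ᵇ y in e
... | true  = ⊥-elim (<⇒≱ (<ᵇ-true⇒< e) y≤x)
... | false = refl

allᵇ-elim : (p : A → Bool) {xs : List A} → allᵇ p xs ≡ true → ∀ {x} → x ∈ xs → p x ≡ true
allᵇ-elim p e (here refl) = ∧-trueˡ e
allᵇ-elim p {y ∷ _} e (there x∈xs) = allᵇ-elim p (∧-trueʳ {p y} e) x∈xs

allᵇ-intro : (p : A → Bool) (xs : List A) → (∀ x → p x ≡ true) → allᵇ p xs ≡ true
allᵇ-intro p []       h = refl
allᵇ-intro p (x ∷ xs) h = ∧-true (h x) (allᵇ-intro p xs h)

allᵇ-allFin : (p : Fin n → Bool) → allᵇ p (allFin n) ≡ true → ∀ i → p i ≡ true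
allᵇ-allFin p e i = allᵇ-elim p e (∈-allFin i)

anyᵇ-elim : (p : A → Bool) (xs : List A) → anyᵇ p xs ≡ true → ∃[ x ] p x ≡ true
anyᵇ-elim p (x ∷ xs) e with p x in px
... | true  = x , px
... | false = anyᵇ-elim p xs e

anyᵇ-intro : (p : A → Bool) (xs : List A) → ∀ {x} → x ∈ xs → p x ≡ true → anyᵇ p xs ≡ true
anyᵇ-intro p (y ∷ xs) (here refl) e rewrite e = refl
anyᵇ-intro p (y ∷ xs) (there x∈xs) e with p y
... | true  = refl
... | false = anyᵇ-intro p xs x∈xs e

∈-allVecs : (v : Vec (Fin n) k) → v ∈ allVecs k n
∈-allVecs []                = here refl
∈-allVecs {n} (x ∷ v) =
  ∈-concat⁺′ (∈-map⁺ (_∷ v) (∈-allFin x)) (∈-map⁺ (λ w → map (_∷ w) (allFin n)) (∈-allVecs v))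

-- Words over Fin m as functions on ℕ, with junk value 0 beyond the length

⟦_⟧ : Vec (Fin m) k → ℕ → ℕ
⟦ [] ⟧    j       = 0
⟦ x ∷ v ⟧ zero    = toℕ x
⟦ x ∷ v ⟧ (suc j) = ⟦ v ⟧ j

⟦⟧-lookup : (v : Vec (Fin m) k) (i : Fin k) → ⟦ v ⟧ (toℕ i) ≡ toℕ (lookup v i)
⟦⟧-lookup (x ∷ v) fz     = refl
⟦⟧-lookup (x ∷ v) (fs i) = ⟦⟧-lookup v i

⟦⟧-fromℕ< : (v : Vec (Fin m) k) {j : ℕ} (j<k : j < k) → ⟦ v ⟧ j ≡ toℕ (lookup v (fromℕ< j<k))
⟦⟧-fromℕ< v j<k = trans (cong ⟦ v ⟧ (sym (Finₚ.toℕ-fromℕ< j<k))) (⟦⟧-lookup v (fromℕ< j<k))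

⟦⟧-< : (v : Vec (Fin m) k) → ∀ {j} → j < k → ⟦ v ⟧ j < m
⟦⟧-< (x ∷ v) {zero}  _         = Finₚ.toℕ<n x
⟦⟧-< (x ∷ v) {suc j} (s≤s j<k) = ⟦⟧-< v j<k

⟦⟧-injective : (v w : Vec (Fin m) k) → (∀ {j} → j < k → ⟦ v ⟧ j ≡ ⟦ w ⟧ j) → v ≡ w
⟦⟧-injective []      []      e = refl
⟦⟧-injective (x ∷ v) (y ∷ w) e = cong₂ _∷_ (Finₚ.toℕ-injective (e (s≤s z≤n))) (⟦⟧-injective v w (e ∘ s≤s))

⟦⟧-tabulate : (h : Fin k → Fin m) {j : ℕ} (j<k : j < k) → ⟦ tabulate h ⟧ j ≡ toℕ (h (fromℕ< j<k))
⟦⟧-tabulate h j<k = trans (⟦⟧-fromℕ< (tabulate h) j<k) (cong toℕ (Vecₚ.lookup∘tabulate h (fromℕ< j<k)))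

clamp : (m : ℕ) → ℕ → Fin (suc m)
clamp zero    x       = fz
clamp (suc m) zero    = fz
clamp (suc m) (suc x) = fs (clamp m x)

toℕ-clamp : ∀ m {x} → x ≤ m → toℕ (clamp m x) ≡ x
toℕ-clamp zero    z≤n       = refl
toℕ-clamp (suc m) z≤n       = refl
toℕ-clamp (suc m) (s≤s x≤m) = cong suc (toℕ-clamp m x≤m)

fromFunction : (m k : ℕ) → (ℕ → ℕ) → Vec (Fin (suc m)) k
fromFunction m k F = tabulate (clamp m ∘ F ∘ toℕ)

⟦fromFunction⟧ : ∀ m k F {j} → j < k → F j ≤ m → ⟦ fromFunction m k F ⟧ j ≡ F j
⟦fromFunction⟧ m k F j<k Fj≤m = begin
  ⟦ fromFunction m k F ⟧ _              ≡⟨ ⟦⟧-tabulate (clamp m ∘ F ∘ toℕ) j<k ⟩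
  toℕ (clamp m (F (toℕ (fromℕ< j<k)))) ≡⟨ cong (toℕ ∘ clamp m ∘ F) (Finₚ.toℕ-fromℕ< j<k) ⟩
  toℕ (clamp m (F _))                   ≡⟨ toℕ-clamp m Fj≤m ⟩
  F _                                   ∎
  where open ≡-Reasoning

-- Permutations and the patterns 231 and 321

injective⇒surjective : (G : Fin n → Fin n) → (∀ {I J} → G I ≡ G J → I ≡ J) → ∀ Y → ∃[ I ] G I ≡ Y
injective⇒surjective {suc n} G G-inj Y with Finₚ.any? (λ I → G I Fin.≟ Y)
... | yes hit = hit
... | no miss = ⊥-elim (Finₚ.<⇒notInjective ≤-refl H-inj)
  where
  avoids-Y : ∀ I → Y ≢ G I
  avoids-Y I eq = miss (I , sym eq)
  H : Fin (suc n) → Fin n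
  H I = Fin.punchOut (avoids-Y I)
  H-inj : ∀ {I J} → H I ≡ H J → I ≡ J
  H-inj {I} {J} e = G-inj (Finₚ.punchOut-injective (avoids-Y I) (avoids-Y J) e)

record IsPermutation (n : ℕ) (f : ℕ → ℕ) : Set where
  field
    bounded   : ∀ {i} → i < n → f i < n
    injective : ∀ {i j} → i < n → j < n → f i ≡ f j → i ≡ j

  surjective : ∀ {y} → y < n → ∃[ i ] i < n × f i ≡ y
  surjective y<n with injective⇒surjective G G-inj (fromℕ< y<n)
    where
    G : Fin n → Fin n
    G I = fromℕ< (bounded (Finₚ.toℕ<n I))
    G-inj : ∀ {I J} → G I ≡ G J → I ≡ J
    G-inj {I} {J} e = Finₚ.toℕ-injective (injective (Finₚ.toℕ<n I) (Finₚ.toℕ<n J)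
      (trans (sym (Finₚ.toℕ-fromℕ< _)) (trans (cong toℕ e) (Finₚ.toℕ-fromℕ< _))))
  ... | I , e = toℕ I , Finₚ.toℕ<n I , trans (sym (Finₚ.toℕ-fromℕ< _)) (trans (cong toℕ e) (Finₚ.toℕ-fromℕ< y<n))

isPerm⇒IsPermutation : (σ : Vec (Fin n) n) → isPerm σ ≡ true → IsPermutation n ⟦ σ ⟧
isPerm⇒IsPermutation {n} σ e = record { bounded = ⟦⟧-< σ ; injective = inj }
  where
  inj : ∀ {i j} → i < n → j < n → ⟦ σ ⟧ i ≡ ⟦ σ ⟧ j → i ≡ j
  inj {i} {j} i<n j<n σi≡σj = trans (sym (Finₚ.toℕ-fromℕ< i<n)) (trans (≡ᵇ-true⇒≡ I=J) (Finₚ.toℕ-fromℕ< j<n))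
    where
    I = fromℕ< i<n
    J = fromℕ< j<n
    I=J : (I =ᶠ J) ≡ true
    I=J with I =ᶠ J | allᵇ-allFin _ (allᵇ-allFin _ e I) J
    ... | true  | _ = refl
    ... | false | h rewrite ≡⇒≡ᵇ-true (trans (sym (⟦⟧-fromℕ< σ i<n)) (trans σi≡σj (⟦⟧-fromℕ< σ j<n)))
      with () ← h

IsPermutation⇒isPerm : (σ : Vec (Fin n) n) → IsPermutation n ⟦ σ ⟧ → isPerm σ ≡ true
IsPermutation⇒isPerm {n} σ perm = allᵇ-intro _ (allFin n) (λ I → allᵇ-intro _ (allFin n) (entry I))
  where
  entry : ∀ I J → ((I =ᶠ J) ∨ not (lookup σ I =ᶠ lookup σ J)) ≡ true
  entry I J with I =ᶠ J in I≠J
  ... | true  = refl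
  ... | false with lookup σ I =ᶠ lookup σ J in σI=σJ
  ...   | false = refl
  ...   | true with () ← trans (sym (≡⇒≡ᵇ-true (IsPermutation.injective perm (Finₚ.toℕ<n I) (Finₚ.toℕ<n J)
                    (trans (⟦⟧-lookup σ I) (trans (≡ᵇ-true⇒≡ σI=σJ) (sym (⟦⟧-lookup σ J))))))) I≠J

findFirst-satisfies : (p : Fin n → Bool) (d : Fin n) (xs : List (Fin n)) → ∀ {x} → x ∈ xs → p x ≡ true →
                      p (findFirst p d xs) ≡ true
findFirst-satisfies p d (y ∷ xs) x∈ px with p y in py
... | true = py
findFirst-satisfies p d (y ∷ xs) (here refl)  px | false with () ← trans (sym px) py
findFirst-satisfies p d (y ∷ xs) (there x∈xs) px | false = findFirst-satisfies p d xs x∈xs px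

⟦inverse⟧-inverseʳ : (σ : Vec (Fin n) n) → IsPermutation n ⟦ σ ⟧ →
                     ∀ {j} → j < n → ⟦ σ ⟧ (⟦ inverse σ ⟧ j) ≡ j
⟦inverse⟧-inverseʳ {n} σ perm {j} j<n with IsPermutation.surjective perm j<n
... | i , i<n , σi≡j = begin
  ⟦ σ ⟧ (⟦ inverse σ ⟧ j) ≡⟨ cong ⟦ σ ⟧ (⟦⟧-tabulate (λ J → findFirst (λ i → lookup σ i =ᶠ J) J (allFin n)) j<n) ⟩
  ⟦ σ ⟧ (toℕ X)           ≡⟨ ⟦⟧-lookup σ X ⟩
  toℕ (lookup σ X)        ≡⟨ ≡ᵇ-true⇒≡ (findFirst-satisfies p J (allFin n) (∈-allFin (fromℕ< i<n)) p-at-i) ⟩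
  toℕ J                   ≡⟨ Finₚ.toℕ-fromℕ< j<n ⟩
  j                       ∎
  where
  open ≡-Reasoning
  J = fromℕ< j<n
  p : Fin n → Bool
  p i = lookup σ i =ᶠ J
  X = findFirst p J (allFin n)
  p-at-i : p (fromℕ< i<n) ≡ true
  p-at-i = ≡⇒≡ᵇ-true (trans (sym (⟦⟧-fromℕ< σ i<n)) (trans σi≡j (sym (Finₚ.toℕ-fromℕ< j<n))))

⟦inverse⟧-inverseˡ : (σ : Vec (Fin n) n) → IsPermutation n ⟦ σ ⟧ →
                     ∀ {i} → i < n → ⟦ inverse σ ⟧ (⟦ σ ⟧ i) ≡ i
⟦inverse⟧-inverseˡ σ perm i<n = IsPermutation.injective perm (⟦⟧-< (inverse σ) σi<n) i<n
  (⟦inverse⟧-inverseʳ σ perm σi<n)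
  where σi<n = ⟦⟧-< σ i<n

⟦compose⟧ : (τ ρ : Vec (Fin n) n) → ∀ {j} → j < n → ⟦ compose τ ρ ⟧ j ≡ ⟦ τ ⟧ (⟦ ρ ⟧ j)
⟦compose⟧ τ ρ j<n =
  trans (⟦⟧-tabulate _ j<n) (trans (sym (⟦⟧-lookup τ _)) (cong ⟦ τ ⟧ (sym (⟦⟧-fromℕ< ρ j<n))))

-- Both 231 and 321 end with their smallest entry, so a permutation avoids both iff no entry is preceded by two
-- larger ones (the patterns differ only in the order of those two).
Avoids : ℕ → (ℕ → ℕ) → Set
Avoids n f = ∀ a b c → a < b → b < c → c < n → f c < f a → f c < f b → ⊥

StrictlyIncreasing : (Fin k → ℕ) → Set
StrictlyIncreasing h = h Preserves Fin._<_ ⟶ _<_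

Fin3-strictlyIncreasing : (h : Fin 3 → ℕ) → h fz < h (fs fz) → h (fs fz) < h (fs (fs fz)) → StrictlyIncreasing h
Fin3-strictlyIncreasing h h01 h12 {fz}      {fs fz}      _ = h01
Fin3-strictlyIncreasing h h01 h12 {fz}      {fs (fs fz)} _ = <-trans h01 h12
Fin3-strictlyIncreasing h h01 h12 {fs fz}   {fs (fs fz)} _ = h12
Fin3-strictlyIncreasing h h01 h12 {fz}      {fz}         ()
Fin3-strictlyIncreasing h h01 h12 {fs fz}   {fz}         ()
Fin3-strictlyIncreasing h h01 h12 {fs fz}   {fs fz}      (s≤s ())
Fin3-strictlyIncreasing h h01 h12 {fs (fs fz)} {fz}      ()
Fin3-strictlyIncreasing h h01 h12 {fs (fs fz)} {fs fz}   (s≤s ())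
Fin3-strictlyIncreasing h h01 h12 {fs (fs fz)} {fs (fs fz)} (s≤s (s≤s ()))

increasing-elim : (c : Vec (Fin n) k) → increasing c ≡ true → StrictlyIncreasing (toℕ ∘ lookup c)
increasing-elim c e {i} {j} i<j with allᵇ-allFin _ (allᵇ-allFin _ e i) j
... | h rewrite <⇒<ᵇ-true i<j = <ᵇ-true⇒< h

increasing-intro : (c : Vec (Fin n) k) → StrictlyIncreasing (toℕ ∘ lookup c) → increasing c ≡ true
increasing-intro {k = k} c mono = allᵇ-intro _ (allFin k) (λ i → allᵇ-intro _ (allFin k) (entry i))
  where
  entry : ∀ i j → (not (i <ᶠ j) ∨ (lookup c i <ᶠ lookup c j)) ≡ true
  entry i j with i <ᶠ j in i<j
  ... | true  = <⇒<ᵇ-true (mono (<ᵇ-true⇒< i<j))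
  ... | false = refl

orderIso-elim : (τ : Vec (Fin n) n) (π : Vec (Fin k) k) (c : Vec (Fin n) k) → orderIso τ π c ≡ true →
                ∀ i j → (lookup τ (lookup c i) <ᶠ lookup τ (lookup c j)) ≡ (lookup π i <ᶠ lookup π j)
orderIso-elim τ π c e i j with lookup τ (lookup c i) <ᶠ lookup τ (lookup c j) | lookup π i <ᶠ lookup π j
                             | allᵇ-allFin _ (allᵇ-allFin _ e i) j
... | true  | true  | _ = refl
... | false | false | _ = refl

-- Every comparison in the definition of orderIso evaluates to a constant.
orderIso-231 : (τ : Vec (Fin n) n) (x y z : Fin n) → toℕ (lookup τ z) < toℕ (lookup τ x) →
               toℕ (lookup τ x) < toℕ (lookup τ y) → orderIso τ p231 (x ∷ y ∷ z ∷ []) ≡ true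
orderIso-231 τ x y z z<x x<y
  rewrite <⇒<ᵇ-true z<x | <⇒<ᵇ-true x<y | <⇒<ᵇ-true (<-trans z<x x<y)
        | ≥⇒<ᵇ-false (<⇒≤ z<x) | ≥⇒<ᵇ-false (<⇒≤ x<y) | ≥⇒<ᵇ-false (<⇒≤ (<-trans z<x x<y))
        | ≥⇒<ᵇ-false (≤-refl {toℕ (lookup τ x)}) | ≥⇒<ᵇ-false (≤-refl {toℕ (lookup τ y)})
        | ≥⇒<ᵇ-false (≤-refl {toℕ (lookup τ z)}) = refl

orderIso-321 : (τ : Vec (Fin n) n) (x y z : Fin n) → toℕ (lookup τ z) < toℕ (lookup τ y) →
               toℕ (lookup τ y) < toℕ (lookup τ x) → orderIso τ p321 (x ∷ y ∷ z ∷ []) ≡ true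
orderIso-321 τ x y z z<y y<x
  rewrite <⇒<ᵇ-true z<y | <⇒<ᵇ-true y<x | <⇒<ᵇ-true (<-trans z<y y<x)
        | ≥⇒<ᵇ-false (<⇒≤ z<y) | ≥⇒<ᵇ-false (<⇒≤ y<x) | ≥⇒<ᵇ-false (<⇒≤ (<-trans z<y y<x))
        | ≥⇒<ᵇ-false (≤-refl {toℕ (lookup τ x)}) | ≥⇒<ᵇ-false (≤-refl {toℕ (lookup τ y)})
        | ≥⇒<ᵇ-false (≤-refl {toℕ (lookup τ z)}) = refl

module _ (τ : Vec (Fin n) n) where

  Avoids⇒avoids : (π : Vec (Fin 3) 3) → lookup π (fs (fs fz)) Fin.< lookup π fz →
                  lookup π (fs (fs fz)) Fin.< lookup π (fs fz) → Avoids n ⟦ τ ⟧ → avoids τ π ≡ true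
  Avoids⇒avoids π π2<π0 π2<π1 avoid with contains τ π in e
  ... | false = refl
  ... | true with anyᵇ-elim _ (allVecs 3 n) e
  ...   | x ∷ y ∷ z ∷ [] , inc∧iso = ⊥-elim (avoid (toℕ x) (toℕ y) (toℕ z)
            (mono {fz} {fs fz} (s≤s z≤n)) (mono {fs fz} {fs (fs fz)} (s≤s (s≤s z≤n))) (Finₚ.toℕ<n z)
            (below fz π2<π0) (below (fs fz) π2<π1))
    where
    c = x ∷ y ∷ z ∷ []
    mono = increasing-elim c (∧-trueˡ inc∧iso)
    below : ∀ i → lookup π (fs (fs fz)) Fin.< lookup π i → ⟦ τ ⟧ (toℕ z) < ⟦ τ ⟧ (toℕ (lookup c i))
    below i πz<πi = subst₂ _<_ (sym (⟦⟧-lookup τ z)) (sym (⟦⟧-lookup τ (lookup c i)))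
      (<ᵇ-true⇒< (trans (orderIso-elim τ π c (∧-trueʳ {increasing c} inc∧iso) (fs (fs fz)) i) (<⇒<ᵇ-true πz<πi)))

  module _ {a b c} (a<b : a < b) (b<c : b < c) (c<n : c < n) where
    private
      b<n = <-trans b<c c<n
      a<n = <-trans a<b b<n
      positions : Vec (Fin n) 3
      positions = fromℕ< a<n ∷ fromℕ< b<n ∷ fromℕ< c<n ∷ []
      increasing-positions : StrictlyIncreasing (toℕ ∘ lookup positions)
      increasing-positions = Fin3-strictlyIncreasing _
        (subst₂ _<_ (sym (Finₚ.toℕ-fromℕ< a<n)) (sym (Finₚ.toℕ-fromℕ< b<n)) a<b)
        (subst₂ _<_ (sym (Finₚ.toℕ-fromℕ< b<n)) (sym (Finₚ.toℕ-fromℕ< c<n)) b<c)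
      τ-at : ∀ {j} (j<n : j < n) → ⟦ τ ⟧ j ≡ toℕ (lookup τ (fromℕ< j<n))
      τ-at = ⟦⟧-fromℕ< τ

    contains231 : ⟦ τ ⟧ c < ⟦ τ ⟧ a → ⟦ τ ⟧ a < ⟦ τ ⟧ b → contains τ p231 ≡ true
    contains231 τc<τa τa<τb = anyᵇ-intro _ (allVecs 3 n) (∈-allVecs positions) (∧-true
      (increasing-intro positions increasing-positions)
      (orderIso-231 τ _ _ _ (subst₂ _<_ (τ-at c<n) (τ-at a<n) τc<τa) (subst₂ _<_ (τ-at a<n) (τ-at b<n) τa<τb)))

    contains321 : ⟦ τ ⟧ c < ⟦ τ ⟧ b → ⟦ τ ⟧ b < ⟦ τ ⟧ a → contains τ p321 ≡ true
    contains321 τc<τb τb<τa = anyᵇ-intro _ (allVecs 3 n) (∈-allVecs positions) (∧-true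
      (increasing-intro positions increasing-positions)
      (orderIso-321 τ _ _ _ (subst₂ _<_ (τ-at c<n) (τ-at b<n) τc<τb) (subst₂ _<_ (τ-at b<n) (τ-at a<n) τb<τa)))

  avoids⇒Avoids : IsPermutation n ⟦ τ ⟧ → avoids τ p231 ≡ true → avoids τ p321 ≡ true → Avoids n ⟦ τ ⟧
  avoids⇒Avoids perm no231 no321 a b c a<b b<c c<n τc<τa τc<τb with <-cmp (⟦ τ ⟧ a) (⟦ τ ⟧ b)
  ... | tri< τa<τb _ _ with () ← trans (sym no231) (cong not (contains231 a<b b<c c<n τc<τa τa<τb))
  ... | tri> _ _ τb<τa with () ← trans (sym no321) (cong not (contains321 a<b b<c c<n τc<τb τb<τa))
  ... | tri≈ _ τa≡τb _ = <-irrefl (IsPermutation.injective perm (<-trans a<b (<-trans b<c c<n)) (<-trans b<c c<n) τa≡τb) a<b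

-- g ∘ f⁻¹ avoids 231 and 321, written at the positions f i < f j < f l so that f⁻¹ does not appear.
AvoidsRel : ℕ → (ℕ → ℕ) → (ℕ → ℕ) → Set
AvoidsRel n f g = ∀ i j l → i < n → j < n → l < n → f i < f j → f j < f l → g l < g i → g l < g j → ⊥

record GoodPair (n : ℕ) (f g : ℕ → ℕ) : Set where
  field
    perm₁     : IsPermutation n f
    perm₂     : IsPermutation n g
    avoids₁   : Avoids n f
    avoids₂   : Avoids n g
    avoidsRel : AvoidsRel n f g

Pair : ℕ → Set
Pair n = Vec (Fin n) n × Vec (Fin n) n

isGood : Pair n → Bool
isGood (σ , σ′) = isPerm σ ∧ isPerm σ′ ∧ avoids3 σ σ′ p231 ∧ avoids3 σ σ′ p321

module Relative (σ σ′ : Vec (Fin n) n) (perm : IsPermutation n ⟦ σ ⟧) where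
  ρ : Vec (Fin n) n
  ρ = compose σ′ (inverse σ)

  private
    σ⁻¹<n : ∀ {j} → j < n → ⟦ inverse σ ⟧ j < n
    σ⁻¹<n = ⟦⟧-< (inverse σ)
    σ<n : ∀ {i} → i < n → ⟦ σ ⟧ i < n
    σ<n = ⟦⟧-< σ
    σσ⁻¹ : ∀ {j} → j < n → ⟦ σ ⟧ (⟦ inverse σ ⟧ j) ≡ j
    σσ⁻¹ = ⟦inverse⟧-inverseʳ σ perm

  ⟦ρ⟧ : ∀ {j} → j < n → ⟦ ρ ⟧ j ≡ ⟦ σ′ ⟧ (⟦ inverse σ ⟧ j)
  ⟦ρ⟧ = ⟦compose⟧ σ′ (inverse σ)

  ⟦ρ⟧∘⟦σ⟧ : ∀ {i} → i < n → ⟦ ρ ⟧ (⟦ σ ⟧ i) ≡ ⟦ σ′ ⟧ i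
  ⟦ρ⟧∘⟦σ⟧ i<n = trans (⟦ρ⟧ (σ<n i<n)) (cong ⟦ σ′ ⟧ (⟦inverse⟧-inverseˡ σ perm i<n))

  ρ-isPermutation : IsPermutation n ⟦ σ′ ⟧ → IsPermutation n ⟦ ρ ⟧
  ρ-isPermutation perm′ = record { bounded = ⟦⟧-< ρ ; injective = inj }
    where
    inj : ∀ {x y} → x < n → y < n → ⟦ ρ ⟧ x ≡ ⟦ ρ ⟧ y → x ≡ y
    inj x<n y<n ρx≡ρy = trans (sym (σσ⁻¹ x<n)) (trans (cong ⟦ σ ⟧ σ⁻¹x≡σ⁻¹y) (σσ⁻¹ y<n))
      where
      σ⁻¹x≡σ⁻¹y = IsPermutation.injective perm′ (σ⁻¹<n x<n) (σ⁻¹<n y<n)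
                    (trans (sym (⟦ρ⟧ x<n)) (trans ρx≡ρy (⟦ρ⟧ y<n)))

  Avoids⇒AvoidsRel : Avoids n ⟦ ρ ⟧ → AvoidsRel n ⟦ σ ⟧ ⟦ σ′ ⟧
  Avoids⇒AvoidsRel avoid i j l i<n j<n l<n σi<σj σj<σl σ′l<σ′i σ′l<σ′j =
    avoid (⟦ σ ⟧ i) (⟦ σ ⟧ j) (⟦ σ ⟧ l) σi<σj σj<σl (σ<n l<n)
      (subst₂ _<_ (sym (⟦ρ⟧∘⟦σ⟧ l<n)) (sym (⟦ρ⟧∘⟦σ⟧ i<n)) σ′l<σ′i)
      (subst₂ _<_ (sym (⟦ρ⟧∘⟦σ⟧ l<n)) (sym (⟦ρ⟧∘⟦σ⟧ j<n)) σ′l<σ′j)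

  AvoidsRel⇒Avoids : AvoidsRel n ⟦ σ ⟧ ⟦ σ′ ⟧ → Avoids n ⟦ ρ ⟧
  AvoidsRel⇒Avoids avoid a b c a<b b<c c<n ρc<ρa ρc<ρb =
    avoid _ _ _ (σ⁻¹<n a<n) (σ⁻¹<n b<n) (σ⁻¹<n c<n)
      (subst₂ _<_ (sym (σσ⁻¹ a<n)) (sym (σσ⁻¹ b<n)) a<b) (subst₂ _<_ (sym (σσ⁻¹ b<n)) (sym (σσ⁻¹ c<n)) b<c)
      (subst₂ _<_ (⟦ρ⟧ c<n) (⟦ρ⟧ a<n) ρc<ρa) (subst₂ _<_ (⟦ρ⟧ c<n) (⟦ρ⟧ b<n) ρc<ρb)
    where
    b<n = <-trans b<c c<n
    a<n = <-trans a<b b<n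

isGood⇒GoodPair : (w : Pair n) → isGood w ≡ true → GoodPair n ⟦ proj₁ w ⟧ ⟦ proj₂ w ⟧
isGood⇒GoodPair (σ , σ′) e = record
  { perm₁     = perm
  ; perm₂     = perm′
  ; avoids₁   = avoids⇒Avoids σ perm (∧-trueˡ no231) (∧-trueˡ no321)
  ; avoids₂   = avoids⇒Avoids σ′ perm′ (∧-trueˡ (∧-trueʳ {avoids σ p231} no231))
                                       (∧-trueˡ (∧-trueʳ {avoids σ p321} no321))
  ; avoidsRel = R.Avoids⇒AvoidsRel (avoids⇒Avoids R.ρ (R.ρ-isPermutation perm′)
                  (∧-trueʳ {avoids σ′ p231} (∧-trueʳ {avoids σ p231} no231))
                  (∧-trueʳ {avoids σ′ p321} (∧-trueʳ {avoids σ p321} no321)))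
  }
  where
  perm  = isPerm⇒IsPermutation σ (∧-trueˡ e)
  e′    = ∧-trueʳ {isPerm σ} e
  perm′ = isPerm⇒IsPermutation σ′ (∧-trueˡ e′)
  e″    = ∧-trueʳ {isPerm σ′} e′
  no231 = ∧-trueˡ e″
  no321 = ∧-trueʳ {avoids3 σ σ′ p231} e″
  module R = Relative σ σ′ perm

GoodPair⇒isGood : (w : Pair n) → GoodPair n ⟦ proj₁ w ⟧ ⟦ proj₂ w ⟧ → isGood w ≡ true
GoodPair⇒isGood (σ , σ′) good =
  ∧-true (IsPermutation⇒isPerm σ perm₁) (∧-true (IsPermutation⇒isPerm σ′ perm₂)
    (∧-true (∧-true (no231 σ avoids₁) (∧-true (no231 σ′ avoids₂) (no231 R.ρ avoidsρ)))
            (∧-true (no321 σ avoids₁) (∧-true (no321 σ′ avoids₂) (no321 R.ρ avoidsρ)))))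
  where
  open GoodPair good
  module R = Relative σ σ′ perm₁
  avoidsρ = R.AvoidsRel⇒Avoids avoidsRel
  no231 : (τ : Vec (Fin n) n) → Avoids n ⟦ τ ⟧ → avoids τ p231 ≡ true
  no231 τ = Avoids⇒avoids τ p231 (s≤s z≤n) (s≤s z≤n)
  no321 : (τ : Vec (Fin n) n) → Avoids n ⟦ τ ⟧ → avoids τ p321 ≡ true
  no321 τ = Avoids⇒avoids τ p321 (s≤s z≤n) (s≤s z≤n)

-- Appending and deleting a last entry

squeeze : k ≤ x → x ≤ suc k → x ≡ k ⊎ x ≡ suc k
squeeze {k} k≤x x≤1+k with m≤n⇒m<n∨m≡n x≤1+k
... | inj₁ x<1+k = inj₁ (≤-antisym (s≤s⁻¹ x<1+k) k≤x)
... | inj₂ x≡1+k = inj₂ x≡1+k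

front-or-last : i < suc (suc k) → i ≤ k ⊎ i ≡ suc k
front-or-last i<2+k with m≤n⇒m<n∨m≡n (s≤s⁻¹ i<2+k)
... | inj₁ i<1+k = inj₁ (s≤s⁻¹ i<1+k)
... | inj₂ i≡1+k = inj₂ i≡1+k

front<last : i ≤ k → i < suc (suc k)
front<last i≤k = s≤s (m≤n⇒m≤1+n i≤k)

-- Appending the value newLast b k to a permutation of [0, k] relabels the old values by relabel b k; lower k
-- undoes this after the last entry is deleted.
newLast : Bool → ℕ → ℕ
newLast true  k = suc k
newLast false k = k

relabel : Bool → ℕ → ℕ → ℕ
relabel true  k x = x
relabel false k x with x ≟ k
... | yes _ = suc k
... | no  _ = x

lower : ℕ → ℕ → ℕ
lower k y with y ≟ suc k
... | yes _ = k
... | no  _ = y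

k≤newLast : ∀ b → k ≤ newLast b k
k≤newLast true  = n≤1+n _
k≤newLast false = ≤-refl

newLast≤1+k : ∀ b → newLast b k ≤ suc k
newLast≤1+k true  = ≤-refl
newLast≤1+k false = n≤1+n _

relabel-≤ : ∀ b → x ≤ k → relabel b k x ≤ suc k
relabel-≤ true x≤k = m≤n⇒m≤1+n x≤k
relabel-≤ {x} {k} false x≤k with x ≟ k
... | yes _ = ≤-refl
... | no  _ = m≤n⇒m≤1+n x≤k

relabel-< : ∀ b → x < y → y ≤ k → relabel b k x < relabel b k y
relabel-< true x<y y≤k = x<y
relabel-< {x} {y} {k} false x<y y≤k with x ≟ k | y ≟ k
... | yes refl | _     = contradiction (<-≤-trans x<y y≤k) (<-irrefl refl)
... | no _     | yes _ = s≤s (≤-trans (<⇒≤ x<y) y≤k)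
... | no _     | no _  = x<y

relabel-injective : ∀ b → x ≤ k → y ≤ k → relabel b k x ≡ relabel b k y → x ≡ y
relabel-injective {x} {k} {y} b x≤k y≤k e with <-cmp x y
... | tri< x<y _ _ = contradiction e (<⇒≢ (relabel-< b x<y y≤k))
... | tri≈ _ x≡y _ = x≡y
... | tri> _ _ y<x = contradiction (sym e) (<⇒≢ (relabel-< b y<x x≤k))

relabel-≤-relabel : ∀ b → x ≤ y → y ≤ k → relabel b k x ≤ relabel b k y
relabel-≤-relabel b x≤y y≤k with m≤n⇒m<n∨m≡n x≤y
... | inj₁ x<y  = <⇒≤ (relabel-< b x<y y≤k)
... | inj₂ refl = ≤-refl

relabel-≢-newLast : ∀ b → x ≤ k → relabel b k x ≢ newLast b k
relabel-≢-newLast true x≤k = <⇒≢ (s≤s x≤k)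
relabel-≢-newLast {x} {k} false x≤k with x ≟ k
... | yes _   = <⇒≢ (n<1+n k) ∘ sym
... | no x≢k = x≢k

relabel-≡-1+k : ∀ b → x ≤ k → relabel b k x ≡ suc k → b ≡ false × x ≡ k
relabel-≡-1+k {k = k} true x≤k e = ⊥-elim (1+n≰n (subst (_≤ k) e x≤k))
relabel-≡-1+k {x} {k} false x≤k e with x ≟ k
... | yes x≡k = refl , x≡k
... | no _     = ⊥-elim (1+n≰n (subst (_≤ k) e x≤k))

lower-≤ : y ≤ suc k → lower k y ≤ k
lower-≤ {y} {k} y≤1+k with y ≟ suc k
... | yes _     = ≤-refl
... | no y≢1+k = s≤s⁻¹ (≤∧≢⇒< y≤1+k y≢1+k)

lower-reflects-< : y ≤ suc k → lower k x < lower k y → x < y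
lower-reflects-< {y} {k} {x} y≤1+k lx<ly with x ≟ suc k
... | yes _ = contradiction (lower-≤ y≤1+k) (<⇒≱ lx<ly)
... | no _ with y ≟ suc k
...   | yes refl = <-trans lx<ly (n<1+n k)
...   | no _     = lx<ly

lower-≡ : lower k x ≡ lower k y → x ≡ y ⊎ k ≤ x × k ≤ y
lower-≡ {k} {x} {y} e with x ≟ suc k | y ≟ suc k
... | yes refl | yes refl = inj₁ refl
... | yes refl | no _     = inj₂ (n≤1+n k , ≤-reflexive e)
... | no _     | yes refl = inj₂ (≤-reflexive (sym e) , n≤1+n k)
... | no _     | no _     = inj₁ e

lower≡k⇒k≤ : lower k y ≡ k → k ≤ y
lower≡k⇒k≤ {k} {y} e with y ≟ suc k
... | yes refl = n≤1+n k
... | no _     = ≤-reflexive (sym e)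

k≤⇒lower≡k : k ≤ y → y ≤ suc k → lower k y ≡ k
k≤⇒lower≡k {k} {y} k≤y y≤1+k with y ≟ suc k
... | yes _     = refl
... | no y≢1+k = ≤-antisym (s≤s⁻¹ (≤∧≢⇒< y≤1+k y≢1+k)) k≤y

lower-relabel : ∀ b → x ≤ k → lower k (relabel b k x) ≡ x
lower-relabel {x} {k} true x≤k with x ≟ suc k
... | yes refl = ⊥-elim (1+n≰n x≤k)
... | no _     = refl
lower-relabel {x} {k} false x≤k with x ≟ k
... | yes x≡k = trans (k≤⇒lower≡k (n≤1+n k) ≤-refl) (sym x≡k)
... | no _ with x ≟ suc k
...   | yes refl = ⊥-elim (1+n≰n x≤k)
...   | no _     = refl

relabel-lower : ∀ b → y ≤ suc k → y ≢ newLast b k → relabel b k (lower k y) ≡ y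
relabel-lower {y} {k} true y≤1+k y≢1+k with y ≟ suc k
... | yes y≡1+k = contradiction y≡1+k y≢1+k
... | no _      = refl
relabel-lower {y} {k} false y≤1+k y≢k with y ≟ suc k
... | yes y≡1+k = trans (relabel-k≡1+k k) (sym y≡1+k)
  where
  relabel-k≡1+k : ∀ k → relabel false k k ≡ suc k
  relabel-k≡1+k k with k ≟ k
  ... | yes _   = refl
  ... | no k≢k = contradiction refl k≢k
... | no _ with y ≟ k
...   | yes y≡k = contradiction y≡k y≢k
...   | no _    = refl

extend : Bool → ℕ → (ℕ → ℕ) → ℕ → ℕ
extend b k f i with i ≤? k
... | yes _ = relabel b k (f i)
... | no  _ = newLast b k

trim : ℕ → (ℕ → ℕ) → ℕ → ℕ
trim k f i = lower k (f i)

extend-front : ∀ b → i ≤ k → extend b k f i ≡ relabel b k (f i)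
extend-front {i} {k} b i≤k with i ≤? k
... | yes _   = refl
... | no i≰k = contradiction i≤k i≰k

extend-last : ∀ {k f} b → extend b k f (suc k) ≡ newLast b k
extend-last {k} b with suc k ≤? k
... | yes 1+k≤k = ⊥-elim (1+n≰n 1+k≤k)
... | no _      = refl

extend-cong : ∀ b → (∀ {i} → i ≤ k → f i ≡ g i) → i < suc (suc k) → extend b k f i ≡ extend b k g i
extend-cong {k} {f} {g} b f≗g i<2+k with front-or-last i<2+k
... | inj₁ i≤k = trans (extend-front b i≤k) (trans (cong (relabel b k) (f≗g i≤k)) (sym (extend-front b i≤k)))
... | inj₂ refl = trans (extend-last {k} {f} b) (sym (extend-last {k} {g} b))

front-≤ : IsPermutation (suc k) f → i ≤ k → f i ≤ k
front-≤ perm i≤k = s≤s⁻¹ (IsPermutation.bounded perm (s≤s i≤k))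

below-top-two : x ≤ suc k → x ≢ suc k → x ≢ k → x < k
below-top-two x≤1+k x≢1+k x≢k = ≤∧≢⇒< (s≤s⁻¹ (≤∧≢⇒< x≤1+k x≢1+k)) x≢k

same-top-two : k ≤ x → x ≤ suc k → k ≤ y → y ≤ suc k → k ≤ z → z ≤ suc k → x ≢ z → y ≢ z → x ≡ y
same-top-two k≤x x≤ k≤y y≤ k≤z z≤ x≢z y≢z with squeeze k≤x x≤ | squeeze k≤y y≤ | squeeze k≤z z≤
... | inj₁ x≡k   | inj₁ y≡k   | _          = trans x≡k (sym y≡k)
... | inj₂ x≡1+k | inj₂ y≡1+k | _          = trans x≡1+k (sym y≡1+k)
... | inj₁ x≡k   | inj₂ _     | inj₁ z≡k   = contradiction (trans x≡k (sym z≡k)) x≢z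
... | inj₁ _     | inj₂ y≡1+k | inj₂ z≡1+k = contradiction (trans y≡1+k (sym z≡1+k)) y≢z
... | inj₂ x≡1+k | inj₁ _     | inj₂ z≡1+k = contradiction (trans x≡1+k (sym z≡1+k)) x≢z
... | inj₂ _     | inj₁ y≡k   | inj₁ z≡k   = contradiction (trans y≡k (sym z≡k)) y≢z

Avoids-unordered : ∀ {n a b c} → Avoids n f → a < c → b < c → c < n → a ≢ b → f c < f a → f c < f b → ⊥
Avoids-unordered {a = a} {b} avoid a<c b<c c<n a≢b fc<fa fc<fb with <-cmp a b
... | tri< a<b _ _ = avoid _ _ _ a<b b<c c<n fc<fa fc<fb
... | tri≈ _ a≡b _ = a≢b a≡b
... | tri> _ _ b<a = avoid _ _ _ b<a a<c c<n fc<fb fc<fa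

early-large : IsPermutation (suc (suc k)) f → ∃[ q ] q ≤ k × k ≤ f q
early-large {k} {f} perm with IsPermutation.surjective perm (≤-refl {suc (suc k)})
... | p , p<2+k , fp≡1+k with front-or-last p<2+k
...   | inj₁ p≤k = p , p≤k , ≤-trans (n≤1+n k) (≤-reflexive (sym fp≡1+k))
...   | inj₂ refl with IsPermutation.surjective perm (n≤1+n (suc k))
...     | q , q<2+k , fq≡k with front-or-last q<2+k
...       | inj₁ q≤k = q , q≤k , ≤-reflexive (sym fq≡k)
...       | inj₂ refl = contradiction (trans (sym fq≡k) fp≡1+k) (<⇒≢ (n<1+n k))

last-entry : IsPermutation (suc (suc k)) f → Avoids (suc (suc k)) f → k ≤ f (suc k)
last-entry {k} {f} perm avoid with k ≤? f (suc k)
... | yes k≤last = k≤last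
... | no k≰last with IsPermutation.surjective perm (n≤1+n (suc k)) | IsPermutation.surjective perm (≤-refl {suc (suc k)})
...   | p , p<2+k , fp≡k | q , q<2+k , fq≡1+k =
  ⊥-elim (Avoids-unordered avoid (before-last p<2+k p≢1+k) (before-last q<2+k q≢1+k) ≤-refl p≢q
           (subst (f (suc k) <_) (sym fp≡k) last<k) (subst (f (suc k) <_) (sym fq≡1+k) (<-trans last<k (n<1+n k))))
  where
  last<k = ≰⇒> k≰last
  before-last : x < suc (suc k) → x ≢ suc k → x < suc k
  before-last x<2+k x≢1+k = ≤∧≢⇒< (s≤s⁻¹ x<2+k) x≢1+k
  p≢1+k : p ≢ suc k
  p≢1+k refl = <⇒≢ last<k fp≡k
  q≢1+k : q ≢ suc k
  q≢1+k refl = <⇒≢ (<-trans last<k (n<1+n k)) fq≡1+k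
  p≢q : p ≢ q
  p≢q refl = <⇒≢ (n<1+n k) (trans (sym fp≡k) fq≡1+k)

-- If g i < k, then an early position holding one of the two largest values of g, the last position and i
-- would give an occurrence in g ∘ f⁻¹.
second-top : GoodPair (suc (suc k)) f g → f (suc k) ≡ k → i ≤ k → f i ≡ suc k → k ≤ g i
second-top {k} {f} {g} {i} good fk≡k i≤k fi≡1+k with k ≤? g i
... | yes k≤gi = k≤gi
... | no k≰gi with early-large (GoodPair.perm₂ good)
...   | q , q≤k , k≤gq = ⊥-elim (avoidsRel q (suc k) i (front<last q≤k) ≤-refl (front<last i≤k)
                           fq<last last<fi (<-≤-trans gi<k k≤gq) (<-≤-trans gi<k (last-entry perm₂ avoids₂)))
  where
  open GoodPair good
  gi<k = ≰⇒> k≰gi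
  q≢i : q ≢ i
  q≢i refl = <⇒≱ gi<k k≤gq
  fq<last : f q < f (suc k)
  fq<last = subst (f q <_) (sym fk≡k) (below-top-two (s≤s⁻¹ (IsPermutation.bounded perm₁ (front<last q≤k)))
            (λ fq≡1+k → q≢i (IsPermutation.injective perm₁ (front<last q≤k) (front<last i≤k)
                                (trans fq≡1+k (sym fi≡1+k))))
            (λ fq≡k → <⇒≢ (s≤s q≤k) (IsPermutation.injective perm₁ (front<last q≤k) ≤-refl
                                       (trans fq≡k (sym fk≡k)))))
  last<fi : f (suc k) < f i
  last<fi = subst₂ _<_ (sym fk≡k) (sym fi≡1+k) (n<1+n k)

extend-≤ : ∀ b → (∀ {i} → i ≤ k → f i ≤ k) → i < suc (suc k) → extend b k f i ≤ suc k
extend-≤ b front≤k i<2+k with front-or-last i<2+k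
... | inj₁ i≤k = ≤-trans (≤-reflexive (extend-front b i≤k)) (relabel-≤ b (front≤k i≤k))
... | inj₂ refl = ≤-trans (≤-reflexive (extend-last b)) (newLast≤1+k b)

module Extend {k : ℕ} {f : ℕ → ℕ} (perm : IsPermutation (suc k) f) (b : Bool) where

  extend-isPermutation : IsPermutation (suc (suc k)) (extend b k f)
  extend-isPermutation = record { bounded = s≤s ∘ extend-≤ b (front-≤ perm) ; injective = injective }
    where
    injective : i < suc (suc k) → j < suc (suc k) → extend b k f i ≡ extend b k f j → i ≡ j
    injective i<2+k j<2+k e with front-or-last i<2+k | front-or-last j<2+k
    ... | inj₁ i≤k | inj₁ j≤k = IsPermutation.injective perm (s≤s i≤k) (s≤s j≤k)
      (relabel-injective b (front-≤ perm i≤k) (front-≤ perm j≤k)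
        (trans (sym (extend-front b i≤k)) (trans e (extend-front b j≤k))))
    ... | inj₁ i≤k | inj₂ refl = contradiction (trans (sym (extend-front b i≤k)) (trans e (extend-last b)))
                                   (relabel-≢-newLast b (front-≤ perm i≤k))
    ... | inj₂ refl | inj₁ j≤k = contradiction (trans (sym (extend-front b j≤k)) (trans (sym e) (extend-last b)))
                                   (relabel-≢-newLast b (front-≤ perm j≤k))
    ... | inj₂ refl | inj₂ refl = refl

  -- newLast b k ≥ k, so only the value k + 1 can exceed it.
  extend-above-last : i < suc (suc k) → extend b k f (suc k) < extend b k f i → extend b k f i ≡ suc k
  extend-above-last i<2+k last<Fi = ≤-antisym (extend-≤ b (front-≤ perm) i<2+k)
    (≤-trans (s≤s (≤-trans (k≤newLast b) (≤-reflexive (sym (extend-last b))))) last<Fi)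

  extend-reflects-< : i ≤ k → j ≤ k → extend b k f i < extend b k f j → f i < f j
  extend-reflects-< {i} {j} i≤k j≤k Fi<Fj with <-cmp (f i) (f j)
  ... | tri< fi<fj _ _ = fi<fj
  ... | tri≈ _ fi≡fj _ = contradiction
    (trans (extend-front b i≤k) (trans (cong (relabel b k) fi≡fj) (sym (extend-front b j≤k)))) (<⇒≢ Fi<Fj)
  ... | tri> _ _ fj<fi = contradiction Fi<Fj (<⇒≯ (subst₂ _<_ (sym (extend-front b j≤k)) (sym (extend-front b i≤k))
                           (relabel-< b fj<fi (front-≤ perm i≤k))))

  extend-Avoids : Avoids (suc k) f → Avoids (suc (suc k)) (extend b k f)
  extend-Avoids avoid p q r p<q q<r r<2+k Fr<Fp Fr<Fq with front-or-last r<2+k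
  ... | inj₁ r≤k = avoid p q r p<q q<r (s≤s r≤k)
        (extend-reflects-< r≤k (≤-trans (<⇒≤ (<-trans p<q q<r)) r≤k) Fr<Fp)
        (extend-reflects-< r≤k (≤-trans (<⇒≤ q<r) r≤k) Fr<Fq)
  ... | inj₂ refl = <⇒≢ p<q (IsPermutation.injective extend-isPermutation p<2+k q<2+k
        (trans (extend-above-last p<2+k Fr<Fp) (sym (extend-above-last q<2+k Fr<Fq))))
    where
    q<2+k = <-trans q<r r<2+k
    p<2+k = <-trans p<q q<2+k

-- g ∘ f⁻¹ fixes the largest value m.
RelFixesMax : ℕ → (ℕ → ℕ) → (ℕ → ℕ) → Set
RelFixesMax m f g = ∀ {i} → i ≤ m → f i ≡ m → g i ≡ m

extend-AvoidsRel : IsPermutation (suc k) f → IsPermutation (suc k) g → (b ≡ false → RelFixesMax k f g) →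
                   AvoidsRel (suc k) f g → AvoidsRel (suc (suc k)) (extend b k f) (extend b′ k g)
extend-AvoidsRel {k} {f} {g} {b} {b′} perm-f perm-g fixes avoid i j l i< j< l< Fi<Fj Fj<Fl Gl<Gi Gl<Gj
  with front-or-last l<
... | inj₂ refl = <⇒≢ Fi<Fj (cong (extend b k f) i≡j)
  where
  module G = Extend perm-g b′
  i≡j : i ≡ j
  i≡j = IsPermutation.injective G.extend-isPermutation i< j<
          (trans (G.extend-above-last i< Gl<Gi) (sym (G.extend-above-last j< Gl<Gj)))
... | inj₁ l≤k with front-or-last i<
...   | inj₂ refl = <⇒≢ Fj<Fl (cong (extend b k f) j≡l)
  where
  module F = Extend perm-f b
  j≡l : j ≡ l
  j≡l = IsPermutation.injective F.extend-isPermutation j< l<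
          (trans (F.extend-above-last j< Fi<Fj) (sym (F.extend-above-last l< (<-trans Fi<Fj Fj<Fl))))
...   | inj₁ i≤k with front-or-last j<
...     | inj₁ j≤k = avoid i j l (s≤s i≤k) (s≤s j≤k) (s≤s l≤k)
                       (F.extend-reflects-< i≤k j≤k Fi<Fj) (F.extend-reflects-< j≤k l≤k Fj<Fl)
                       (G.extend-reflects-< l≤k i≤k Gl<Gi) (G.extend-reflects-< l≤k j≤k Gl<Gj)
  where
  module F = Extend perm-f b
  module G = Extend perm-g b′
...     | inj₂ refl = <⇒≱ Gl<Gi (begin
    extend b′ k g i    ≡⟨ extend-front b′ i≤k ⟩
    relabel b′ k (g i) ≤⟨ relabel-≤-relabel b′ (front-≤ perm-g i≤k) ≤-refl ⟩
    relabel b′ k k     ≡⟨ cong (relabel b′ k) (sym (fixes b≡false l≤k fl≡k)) ⟩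
    relabel b′ k (g l) ≡⟨ extend-front b′ l≤k ⟨
    extend b′ k g l    ∎)
  where
  open ≤-Reasoning
  module F = Extend perm-f b
  -- The last entry newLast b k lies below F l, so F l is the value k + 1, which relabel only produces from k.
  Fl≡1+k = F.extend-above-last l< Fj<Fl
  b≡false×fl≡k = relabel-≡-1+k b (front-≤ perm-f l≤k) (trans (sym (extend-front b l≤k)) Fl≡1+k)
  b≡false = proj₁ b≡false×fl≡k
  fl≡k = proj₂ b≡false×fl≡k

extend-GoodPair : GoodPair (suc k) f g → (b ≡ false → RelFixesMax k f g) →
                  GoodPair (suc (suc k)) (extend b k f) (extend b′ k g)
extend-GoodPair {b = b} {b′ = b′} good fixes = record
  { perm₁     = Extend.extend-isPermutation perm₁ b
  ; perm₂     = Extend.extend-isPermutation perm₂ b′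
  ; avoids₁   = Extend.extend-Avoids perm₁ b avoids₁
  ; avoids₂   = Extend.extend-Avoids perm₂ b′ avoids₂
  ; avoidsRel = extend-AvoidsRel perm₁ perm₂ fixes avoidsRel
  }
  where open GoodPair good

module Trim {k : ℕ} {f : ℕ → ℕ} (perm : IsPermutation (suc (suc k)) f) where

  private
    f≤1+k : i ≤ k → f i ≤ suc k
    f≤1+k i≤k = s≤s⁻¹ (IsPermutation.bounded perm (front<last i≤k))

  trim-≤ : i ≤ k → trim k f i ≤ k
  trim-≤ i≤k = lower-≤ (f≤1+k i≤k)

  trim-reflects-< : j ≤ k → trim k f i < trim k f j → f i < f j
  trim-reflects-< j≤k = lower-reflects-< (f≤1+k j≤k)

  trim-isPermutation : k ≤ f (suc k) → IsPermutation (suc k) (trim k f)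
  trim-isPermutation k≤last = record { bounded = s≤s ∘ trim-≤ ∘ s≤s⁻¹ ; injective = injective }
    where
    open IsPermutation perm using () renaming (injective to f-injective; bounded to f-bounded)
    last≤1+k = s≤s⁻¹ (f-bounded ≤-refl)
    ≢last : i ≤ k → f i ≢ f (suc k)
    ≢last i≤k fi≡last = <⇒≢ (s≤s i≤k) (f-injective (front<last i≤k) ≤-refl fi≡last)
    injective : i < suc k → j < suc k → trim k f i ≡ trim k f j → i ≡ j
    injective (s≤s i≤k) (s≤s j≤k) e with lower-≡ e
    ... | inj₁ fi≡fj = f-injective (front<last i≤k) (front<last j≤k) fi≡fj
    -- Both values are among the two largest, as is the last entry, which differs from both.
    ... | inj₂ (k≤fi , k≤fj) = f-injective (front<last i≤k) (front<last j≤k)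
      (same-top-two k≤fi (f≤1+k i≤k) k≤fj (f≤1+k j≤k) k≤last last≤1+k (≢last i≤k) (≢last j≤k))

  trim-Avoids : Avoids (suc (suc k)) f → Avoids (suc k) (trim k f)
  trim-Avoids avoid p q r p<q q<r (s≤s r≤k) tr<tp tr<tq =
    avoid p q r p<q q<r (front<last r≤k) (trim-reflects-< p≤k tr<tp) (trim-reflects-< q≤k tr<tq)
    where
    q≤k = ≤-trans (<⇒≤ q<r) r≤k
    p≤k = ≤-trans (<⇒≤ p<q) q≤k

trim-AvoidsRel : IsPermutation (suc (suc k)) f → IsPermutation (suc (suc k)) g →
                 AvoidsRel (suc (suc k)) f g → AvoidsRel (suc k) (trim k f) (trim k g)
trim-AvoidsRel perm-f perm-g avoid i j l (s≤s i≤k) (s≤s j≤k) (s≤s l≤k) ti<tj tj<tl ul<ui ul<uj =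
  avoid i j l (front<last i≤k) (front<last j≤k) (front<last l≤k)
    (F.trim-reflects-< j≤k ti<tj) (F.trim-reflects-< l≤k tj<tl) (G.trim-reflects-< i≤k ul<ui) (G.trim-reflects-< j≤k ul<uj)
  where
  module F = Trim perm-f
  module G = Trim perm-g

trim-GoodPair : GoodPair (suc (suc k)) f g → GoodPair (suc k) (trim k f) (trim k g)
trim-GoodPair good = record
  { perm₁     = Trim.trim-isPermutation perm₁ (last-entry perm₁ avoids₁)
  ; perm₂     = Trim.trim-isPermutation perm₂ (last-entry perm₂ avoids₂)
  ; avoids₁   = Trim.trim-Avoids perm₁ avoids₁
  ; avoids₂   = Trim.trim-Avoids perm₂ avoids₂
  ; avoidsRel = trim-AvoidsRel perm₁ perm₂ avoidsRel
  }
  where open GoodPair good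

trim-RelFixesMax : GoodPair (suc (suc k)) f g → f (suc k) ≡ k → RelFixesMax k (trim k f) (trim k g)
trim-RelFixesMax {k} {f} {g} good last≡k {i} i≤k ti≡k =
  k≤⇒lower≡k (second-top good last≡k i≤k fi≡1+k) (s≤s⁻¹ (IsPermutation.bounded perm₂ (front<last i≤k)))
  where
  open GoodPair good
  fi≡1+k : f i ≡ suc k
  fi≡1+k with squeeze (lower≡k⇒k≤ ti≡k) (s≤s⁻¹ (IsPermutation.bounded perm₁ (front<last i≤k)))
  ... | inj₂ fi≡1+k = fi≡1+k
  ... | inj₁ fi≡k = contradiction (IsPermutation.injective perm₁ (front<last i≤k) ≤-refl (trans fi≡k (sym last≡k)))
                      (<⇒≢ (s≤s i≤k))

trim∘extend : ∀ b → i ≤ k → f i ≤ k → trim k (extend b k f) i ≡ f i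
trim∘extend b i≤k fi≤k = trans (cong (lower _) (extend-front b i≤k)) (lower-relabel b fi≤k)

extend∘trim : ∀ b → IsPermutation (suc (suc k)) f → f (suc k) ≡ newLast b k →
              i < suc (suc k) → extend b k (trim k f) i ≡ f i
extend∘trim {k} {f} b perm last≡ i<2+k with front-or-last i<2+k
... | inj₂ refl = trans (extend-last b) (sym last≡)
... | inj₁ i≤k = trans (extend-front b i≤k) (relabel-lower b (s≤s⁻¹ (IsPermutation.bounded perm i<2+k))
                   (λ fi≡ → <⇒≢ (s≤s i≤k) (IsPermutation.injective perm i<2+k ≤-refl (trans fi≡ (sym last≡)))))

-- The type of a permutation of [0, m]

endsWithMax : ℕ → (ℕ → ℕ) → Bool
endsWithMax m f = f m ≡ᵇ m

newLast⇒endsWithMax : ∀ b → f (suc k) ≡ newLast b k → endsWithMax (suc k) f ≡ b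
newLast⇒endsWithMax true  last≡1+k = ≡⇒≡ᵇ-true last≡1+k
newLast⇒endsWithMax false last≡k   = ≢⇒≡ᵇ-false (λ last≡1+k → <⇒≢ (n<1+n _) (trans (sym last≡k) last≡1+k))

endsWithMax⇒newLast : IsPermutation (suc (suc k)) f → Avoids (suc (suc k)) f → endsWithMax (suc k) f ≡ b →
                      f (suc k) ≡ newLast b k
endsWithMax⇒newLast {k} {f} perm avoid refl with squeeze (last-entry perm avoid) (s≤s⁻¹ (IsPermutation.bounded perm ≤-refl))
... | inj₁ last≡k   rewrite newLast⇒endsWithMax {f = f} false last≡k = last≡k
... | inj₂ last≡1+k rewrite newLast⇒endsWithMax {f = f} true last≡1+k = last≡1+k

sameEnd⇒RelFixesMax : ∀ m → GoodPair (suc m) f g → endsWithMax m f ≡ endsWithMax m g → RelFixesMax m f g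
sameEnd⇒RelFixesMax zero good _ z≤n _ = n<1⇒n≡0 (IsPermutation.bounded (GoodPair.perm₂ good) (s≤s z≤n))
sameEnd⇒RelFixesMax {f} {g} (suc k) good same = fixes (endsWithMax (suc k) f) refl (sym same)
  where
  open GoodPair good
  fixes : ∀ b → endsWithMax (suc k) f ≡ b → endsWithMax (suc k) g ≡ b → RelFixesMax (suc k) f g
  fixes true ends-f ends-g i≤1+k fi≡1+k = trans (cong g i≡1+k) (endsWithMax⇒newLast perm₂ avoids₂ ends-g)
    where
    i≡1+k = IsPermutation.injective perm₁ (s≤s i≤1+k) ≤-refl
              (trans fi≡1+k (sym (endsWithMax⇒newLast perm₁ avoids₁ ends-f)))
  fixes false ends-f ends-g {i} i≤1+k fi≡1+k =
    ≤-antisym (s≤s⁻¹ (IsPermutation.bounded perm₂ (s≤s i≤1+k)))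
              (≤∧≢⇒< (second-top good last-f i≤k fi≡1+k) (gi≢k ∘ sym))
    where
    last-f = endsWithMax⇒newLast perm₁ avoids₁ ends-f
    i≤k : i ≤ k
    i≤k = s≤s⁻¹ (≤∧≢⇒< i≤1+k (λ { refl → <⇒≢ (n<1+n k) (trans (sym last-f) fi≡1+k) }))
    gi≢k : g i ≢ k
    gi≢k gi≡k = <⇒≢ (s≤s i≤k) (IsPermutation.injective perm₂ (s≤s i≤1+k) ≤-refl
                  (trans gi≡k (sym (endsWithMax⇒newLast perm₂ avoids₂ ends-g))))

RelFixesMax⇒sameEnd : ∀ m → GoodPair (suc m) f g → RelFixesMax m f g → endsWithMax m f ≡ endsWithMax m g
RelFixesMax⇒sameEnd {f} {g} zero good _ rewrite n<1⇒n≡0 (IsPermutation.bounded (GoodPair.perm₁ good) (s≤s z≤n))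
                                         | n<1⇒n≡0 (IsPermutation.bounded (GoodPair.perm₂ good) (s≤s z≤n)) = refl
RelFixesMax⇒sameEnd {f} {g} (suc k) good fixes = agree _ _ refl refl
  where
  open GoodPair good
  agree : ∀ b b′ → endsWithMax (suc k) f ≡ b → endsWithMax (suc k) g ≡ b′ → b ≡ b′
  agree true  true  _ _ = refl
  agree false false _ _ = refl
  agree true false ends-f ends-g = contradiction (trans (sym (fixes ≤-refl (endsWithMax⇒newLast perm₁ avoids₁ ends-f)))
                                                        (endsWithMax⇒newLast perm₂ avoids₂ ends-g))
                                                 (<⇒≢ (n<1+n k) ∘ sym)
  agree false true ends-f ends-g with IsPermutation.surjective perm₁ (≤-refl {suc (suc k)})
  ... | p , p<2+k , fp≡1+k = ⊥-elim (<⇒≢ (n<1+n k)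
    (trans (sym (endsWithMax⇒newLast perm₁ avoids₁ ends-f)) (trans (cong f (sym p≡1+k)) fp≡1+k)))
    where
    p≡1+k = IsPermutation.injective perm₂ p<2+k ≤-refl
              (trans (fixes (s≤s⁻¹ p<2+k) fp≡1+k) (sym (endsWithMax⇒newLast perm₂ avoids₂ ends-g)))

Agree : ℕ → (ℕ → ℕ) → (ℕ → ℕ) → Set
Agree n f f′ = ∀ {i} → i < n → f i ≡ f′ i

IsPermutation-cong : Agree n f f′ → IsPermutation n f → IsPermutation n f′
IsPermutation-cong {n} f≗f′ perm = record
  { bounded   = λ i<n → subst (_< n) (f≗f′ i<n) (bounded i<n)
  ; injective = λ i<n j<n e → injective i<n j<n (trans (f≗f′ i<n) (trans e (sym (f≗f′ j<n))))
  }
  where open IsPermutation perm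

Avoids-cong : Agree n f f′ → Avoids n f → Avoids n f′
Avoids-cong f≗f′ avoid a b c a<b b<c c<n fc<fa fc<fb = avoid a b c a<b b<c c<n
  (subst₂ _<_ (sym (f≗f′ c<n)) (sym (f≗f′ a<n)) fc<fa) (subst₂ _<_ (sym (f≗f′ c<n)) (sym (f≗f′ b<n)) fc<fb)
  where
  b<n = <-trans b<c c<n
  a<n = <-trans a<b b<n

AvoidsRel-cong : Agree n f f′ → Agree n g g′ → AvoidsRel n f g → AvoidsRel n f′ g′
AvoidsRel-cong f≗f′ g≗g′ avoid i j l i<n j<n l<n fi<fj fj<fl gl<gi gl<gj = avoid i j l i<n j<n l<n
  (subst₂ _<_ (sym (f≗f′ i<n)) (sym (f≗f′ j<n)) fi<fj) (subst₂ _<_ (sym (f≗f′ j<n)) (sym (f≗f′ l<n)) fj<fl)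
  (subst₂ _<_ (sym (g≗g′ l<n)) (sym (g≗g′ i<n)) gl<gi) (subst₂ _<_ (sym (g≗g′ l<n)) (sym (g≗g′ j<n)) gl<gj)

GoodPair-cong : Agree n f f′ → Agree n g g′ → GoodPair n f g → GoodPair n f′ g′
GoodPair-cong f≗f′ g≗g′ good = record
  { perm₁     = IsPermutation-cong f≗f′ perm₁
  ; perm₂     = IsPermutation-cong g≗g′ perm₂
  ; avoids₁   = Avoids-cong f≗f′ avoids₁
  ; avoids₂   = Avoids-cong g≗g′ avoids₂
  ; avoidsRel = AvoidsRel-cong f≗f′ g≗g′ avoidsRel
  }
  where open GoodPair good

RelFixesMax-cong : Agree (suc m) f f′ → Agree (suc m) g g′ → RelFixesMax m f g → RelFixesMax m f′ g′
RelFixesMax-cong f≗f′ g≗g′ fixes i≤m f′i≡m =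
  trans (sym (g≗g′ (s≤s i≤m))) (fixes i≤m (trans (f≗f′ (s≤s i≤m)) f′i≡m))

extendVec : Bool → Vec (Fin (suc k)) (suc k) → Vec (Fin (suc (suc k))) (suc (suc k))
extendVec {k} b σ = fromFunction (suc k) (suc (suc k)) (extend b k ⟦ σ ⟧)

trimVec : Vec (Fin (suc (suc k))) (suc (suc k)) → Vec (Fin (suc k)) (suc k)
trimVec {k} σ = fromFunction k (suc k) (trim k ⟦ σ ⟧)

⟦extendVec⟧ : ∀ b (τ : Vec (Fin (suc k)) (suc k)) → Agree (suc (suc k)) ⟦ extendVec b τ ⟧ (extend b k ⟦ τ ⟧)
⟦extendVec⟧ {k} b τ i<2+k = ⟦fromFunction⟧ (suc k) (suc (suc k)) (extend b k ⟦ τ ⟧) i<2+k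
  (extend-≤ b (λ i≤k → s≤s⁻¹ (⟦⟧-< τ (s≤s i≤k))) i<2+k)

⟦trimVec⟧ : (σ : Vec (Fin (suc (suc k))) (suc (suc k))) → Agree (suc k) ⟦ trimVec σ ⟧ (trim k ⟦ σ ⟧)
⟦trimVec⟧ {k} σ (s≤s i≤k) = ⟦fromFunction⟧ k (suc k) (trim k ⟦ σ ⟧) (s≤s i≤k)
  (lower-≤ (s≤s⁻¹ (⟦⟧-< σ (s≤s (m≤n⇒m≤1+n i≤k)))))

trimVec-extendVec : ∀ b (τ : Vec (Fin (suc k)) (suc k)) → trimVec (extendVec b τ) ≡ τ
trimVec-extendVec {k} b τ = ⟦⟧-injective _ τ λ {i} i<1+k → begin
  ⟦ trimVec (extendVec b τ) ⟧ i   ≡⟨ ⟦trimVec⟧ (extendVec b τ) i<1+k ⟩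
  lower k (⟦ extendVec b τ ⟧ i)   ≡⟨ cong (lower k) (⟦extendVec⟧ b τ (s≤s (m≤n⇒m≤1+n (s≤s⁻¹ i<1+k)))) ⟩
  trim k (extend b k ⟦ τ ⟧) i     ≡⟨ trim∘extend b (s≤s⁻¹ i<1+k) (s≤s⁻¹ (⟦⟧-< τ i<1+k)) ⟩
  ⟦ τ ⟧ i                         ∎
  where open ≡-Reasoning

extendVec-trimVec : ∀ b (σ : Vec (Fin (suc (suc k))) (suc (suc k))) → IsPermutation (suc (suc k)) ⟦ σ ⟧ →
                    ⟦ σ ⟧ (suc k) ≡ newLast b k → extendVec b (trimVec σ) ≡ σ
extendVec-trimVec {k} b σ perm last≡ = ⟦⟧-injective _ σ λ {i} i<2+k → begin
  ⟦ extendVec b (trimVec σ) ⟧ i   ≡⟨ ⟦extendVec⟧ b (trimVec σ) i<2+k ⟩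
  extend b k ⟦ trimVec σ ⟧ i      ≡⟨ extend-cong b (⟦trimVec⟧ σ ∘ s≤s) i<2+k ⟩
  extend b k (trim k ⟦ σ ⟧) i     ≡⟨ extend∘trim b perm last≡ i<2+k ⟩
  ⟦ σ ⟧ i                         ∎
  where open ≡-Reasoning

-- Counting good pairs

_==_ : Bool → Bool → Bool
true  == y = y
false == y = not y

==-refl : ∀ b → (b == b) ≡ true
==-refl true  = refl
==-refl false = refl

==-true⇒≡ : ∀ b {y} → (b == y) ≡ true → y ≡ b
==-true⇒≡ true  {true}  _ = refl
==-true⇒≡ false {false} _ = refl

allPairs : ∀ n → List (Pair n)
allPairs n = cartesianProduct (allVecs n n) (allVecs n n)

allPairs-isEnumeration : ∀ n → IsEnumeration (allPairs n)
allPairs-isEnumeration n = cartesianProduct-isEnumeration (allVecs-isEnumeration n n) (allVecs-isEnumeration n n)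

endsWithMaxVec : Vec (Fin (suc m)) (suc m) → Bool
endsWithMaxVec {m} σ = endsWithMax m ⟦ σ ⟧

ofType : Bool → Bool → Pair (suc (suc k)) → Bool
ofType b b′ (σ , σ′) = isGood (σ , σ′) ∧ ((b == endsWithMaxVec σ) ∧ (b′ == endsWithMaxVec σ′))

-- The pairs of size k + 1 that extendPair b b′ maps onto the pairs satisfying ofType b b′.
extendable : Bool → Pair (suc k) → Bool
extendable true  w         = isGood w
extendable false (τ , τ′) = isGood (τ , τ′) ∧ (endsWithMaxVec τ == endsWithMaxVec τ′)

goodCount : ℕ → ℕ
goodCount n = count isGood (allPairs n)

sameTypeCount : ℕ → ℕ
sameTypeCount m = count (extendable false) (allPairs (suc m))

==-intro : ∀ {b y} → y ≡ b → (b == y) ≡ true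
==-intro {b} refl = ==-refl b

extendPair : Bool → Bool → Pair (suc k) → Pair (suc (suc k))
extendPair b b′ (τ , τ′) = extendVec b τ , extendVec b′ τ′

trimPair : Pair (suc (suc k)) → Pair (suc k)
trimPair (σ , σ′) = trimVec σ , trimVec σ′

extendVec-endsWithMax : ∀ b (τ : Vec (Fin (suc k)) (suc k)) → endsWithMaxVec (extendVec b τ) ≡ b
extendVec-endsWithMax {k} b τ =
  newLast⇒endsWithMax {⟦ extendVec b τ ⟧} b (trans (⟦extendVec⟧ b τ ≤-refl) (extend-last {k} {⟦ τ ⟧} b))

extendPair-ofType : ∀ b b′ (w : Pair (suc k)) → extendable b w ≡ true → ofType b b′ (extendPair b b′ w) ≡ true
extendPair-ofType {k} b b′ (τ , τ′) e =
  ∧-true (GoodPair⇒isGood (extendPair b b′ (τ , τ′)) extended)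
         (∧-true (==-intro (extendVec-endsWithMax b τ)) (==-intro (extendVec-endsWithMax b′ τ′)))
  where
  isGood-w : ∀ b → extendable b (τ , τ′) ≡ true → isGood (τ , τ′) ≡ true
  isGood-w true  e = e
  isGood-w false e = ∧-trueˡ e
  good = isGood⇒GoodPair (τ , τ′) (isGood-w b e)
  fixes : b ≡ false → RelFixesMax k ⟦ τ ⟧ ⟦ τ′ ⟧
  fixes refl = sameEnd⇒RelFixesMax k good (sym (==-true⇒≡ (endsWithMaxVec τ) (∧-trueʳ {isGood (τ , τ′)} e)))
  extended = GoodPair-cong (sym ∘ ⟦extendVec⟧ b τ) (sym ∘ ⟦extendVec⟧ b′ τ′) (extend-GoodPair good fixes)

module OfType {b b′ : Bool} (σ σ′ : Vec (Fin (suc (suc k))) (suc (suc k))) (e : ofType b b′ (σ , σ′) ≡ true) where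
  good : GoodPair (suc (suc k)) ⟦ σ ⟧ ⟦ σ′ ⟧
  good = isGood⇒GoodPair (σ , σ′) (∧-trueˡ e)
  open GoodPair good public

  last-σ : ⟦ σ ⟧ (suc k) ≡ newLast b k
  last-σ = endsWithMax⇒newLast perm₁ avoids₁ (==-true⇒≡ b (∧-trueˡ (∧-trueʳ {isGood (σ , σ′)} e)))

  last-σ′ : ⟦ σ′ ⟧ (suc k) ≡ newLast b′ k
  last-σ′ = endsWithMax⇒newLast perm₂ avoids₂
              (==-true⇒≡ b′ (∧-trueʳ {b == endsWithMaxVec σ} (∧-trueʳ {isGood (σ , σ′)} e)))

  trimmed : GoodPair (suc k) ⟦ trimVec σ ⟧ ⟦ trimVec σ′ ⟧
  trimmed = GoodPair-cong (sym ∘ ⟦trimVec⟧ σ) (sym ∘ ⟦trimVec⟧ σ′) (trim-GoodPair good)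

trimPair-extendable : ∀ b b′ (v : Pair (suc (suc k))) → ofType b b′ v ≡ true → extendable b (trimPair v) ≡ true
trimPair-extendable true b′ (σ , σ′) e =
  GoodPair⇒isGood (trimPair (σ , σ′)) (OfType.trimmed {b = true} {b′} σ σ′ e)
trimPair-extendable {k} b@false b′ (σ , σ′) e = ∧-true (GoodPair⇒isGood (trimPair (σ , σ′)) trimmed)
  (==-intro (sym (RelFixesMax⇒sameEnd k trimmed
    (RelFixesMax-cong (sym ∘ ⟦trimVec⟧ σ) (sym ∘ ⟦trimVec⟧ σ′) (trim-RelFixesMax good last-σ)))))
  where open OfType {b = b} {b′} σ σ′ e

extendPair-trimPair : ∀ b b′ (v : Pair (suc (suc k))) → ofType b b′ v ≡ true → extendPair b b′ (trimPair v) ≡ v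
extendPair-trimPair b b′ (σ , σ′) e =
  cong₂ _,_ (extendVec-trimVec b σ perm₁ last-σ) (extendVec-trimVec b′ σ′ perm₂ last-σ′)
  where open OfType {b = b} {b′} σ σ′ e

trimPair-extendPair : ∀ b b′ (w : Pair (suc k)) → trimPair (extendPair b b′ w) ≡ w
trimPair-extendPair b b′ (τ , τ′) = cong₂ _,_ (trimVec-extendVec b τ) (trimVec-extendVec b′ τ′)

ofType-count : ∀ k b b′ → count (ofType b b′) (allPairs (suc (suc k))) ≡ count (extendable b) (allPairs (suc k))
ofType-count k b b′ = count-bijection (Productₚ.≡-dec (Vecₚ.≡-dec Finₚ._≟_) (Vecₚ.≡-dec Finₚ._≟_))
  (allPairs-isEnumeration (suc (suc k))) (allPairs-isEnumeration (suc k)) (ofType b b′) (extendable b)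
  (extendPair b b′) trimPair (extendPair-ofType b b′) (trimPair-extendable b b′)
  (extendPair-trimPair b b′) (λ w _ → trimPair-extendPair b b′ w)

goodCount-byType : ∀ k → goodCount (suc (suc k)) ≡
  (count (ofType true true) (allPairs (suc (suc k))) + count (ofType true false) (allPairs (suc (suc k)))) +
  (count (ofType false true) (allPairs (suc (suc k))) + count (ofType false false) (allPairs (suc (suc k))))
goodCount-byType k = begin
  count isGood xs                                                   ≡⟨ ∑-cong xs byType ⟩
  ∑ (λ w → (ind true true w + ind true false w) + (ind false true w + ind false false w)) xs
                                                                    ≡⟨ ∑-+ _ _ xs ⟩
  ∑ (λ w → ind true true w + ind true false w) xs + ∑ (λ w → ind false true w + ind false false w) xs
                                                                    ≡⟨ cong₂ _+_ (∑-+ _ _ xs) (∑-+ _ _ xs) ⟩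
  _                                                                 ∎
  where
  open ≡-Reasoning
  xs = allPairs (suc (suc k))
  ind : Bool → Bool → Pair (suc (suc k)) → ℕ
  ind b b′ = indicator ∘ ofType b b′
  byType : ∀ w → indicator (isGood w) ≡ (ind true true w + ind true false w) + (ind false true w + ind false false w)
  byType (σ , σ′) with isGood (σ , σ′) | endsWithMaxVec σ | endsWithMaxVec σ′
  ... | false | _     | _     = refl
  ... | true  | true  | true  = refl
  ... | true  | true  | false = refl
  ... | true  | false | true  = refl
  ... | true  | false | false = refl

sameTypeCount-byType : ∀ k → sameTypeCount (suc k) ≡
  count (ofType true true) (allPairs (suc (suc k))) + count (ofType false false) (allPairs (suc (suc k)))
sameTypeCount-byType k = trans (∑-cong (allPairs (suc (suc k))) byType) (∑-+ _ _ (allPairs (suc (suc k))))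
  where
  byType : ∀ w → indicator (extendable false w) ≡ indicator (ofType true true w) + indicator (ofType false false w)
  byType (σ , σ′) with isGood (σ , σ′) | endsWithMaxVec σ | endsWithMaxVec σ′
  ... | false | _     | _     = refl
  ... | true  | true  | true  = refl
  ... | true  | true  | false = refl
  ... | true  | false | true  = refl
  ... | true  | false | false = refl

goodCount-rec : ∀ k → goodCount (suc (suc k)) ≡ (goodCount (suc k) + goodCount (suc k)) + (sameTypeCount k + sameTypeCount k)
goodCount-rec k = trans (goodCount-byType k)
  (cong₂ _+_ (cong₂ _+_ (ofType-count k true true) (ofType-count k true false))
             (cong₂ _+_ (ofType-count k false true) (ofType-count k false false)))

sameTypeCount-rec : ∀ k → sameTypeCount (suc k) ≡ goodCount (suc k) + sameTypeCount k
sameTypeCount-rec k = trans (sameTypeCount-byType k) (cong₂ _+_ (ofType-count k true true) (ofType-count k false false))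

goodCount-1 : goodCount 1 ≡ 1
goodCount-1 = refl

sameTypeCount-0 : sameTypeCount 0 ≡ 1
sameTypeCount-0 = refl

counts : ∀ k → goodCount (suc (suc k)) ≡ 4 * 3 ^ k × sameTypeCount (suc k) ≡ 2 * 3 ^ k
counts zero = trans (goodCount-rec 0) (cong₂ (λ x y → (x + x) + (y + y)) goodCount-1 sameTypeCount-0) ,
              trans (sameTypeCount-rec 0) (cong₂ _+_ goodCount-1 sameTypeCount-0)
counts (suc k) with counts k
... | good≡ , same≡ =
  trans (goodCount-rec (suc k)) (trans (cong₂ (λ x y → (x + x) + (y + y)) good≡ same≡) (step₁ (3 ^ k))) ,
  trans (sameTypeCount-rec (suc k)) (trans (cong₂ _+_ good≡ same≡) (step₂ (3 ^ k)))
  where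
  step₁ : ∀ x → (4 * x + 4 * x) + (2 * x + 2 * x) ≡ 4 * (3 * x)
  step₁ = solve-∀
  step₂ : ∀ x → 4 * x + 2 * x ≡ 2 * (3 * x)
  step₂ = solve-∀

a≡goodCount : ∀ n → a n ≡ goodCount n
a≡goodCount n = trans (length-filterᵇ _ (allPairs n)) (count-cong (allPairs n) λ { (σ , σ′) → refl })

theorem3p4 : (a 1 ≡ 1) × ((n : ℕ) → n ≥ 1 → a (suc n) ≡ 4 * 3 ^ (n ∸ 1))
theorem3p4 = trans (a≡goodCount 1) goodCount-1 , λ { (suc k) _ → trans (a≡goodCount (suc (suc k))) (proj₁ (counts k)) }
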